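{- Let $G=(V,E)$ be a finite tree with positive edge lengths $\{\alpha_e\}$ and distance matrix $D$, and let $S\subseteq V$ be nonempty. Define $\mathbf{m}\in\mathbb{R}^S$ by $\mathbf{m}_v=\sum_{T\in\mathcal{F}_1(G;S)} w(T)\,(2-\operatorname{outdeg}(T,v))$ for $v\in S$. Then $D[S]\mathbf{m}=\lambda\mathbf{1}$, where \[ \lambda=\sum_{e\in E}\alpha_e\sum_{T\in\mathcal{F}_1(G;S)} w(T) \;-\; \sum_{F\in\mathcal{F}_2(G;S)} w(F)\,\big(2-\operatorname{outdeg}(F,*)\big)^2 . \]
   Context: $D$ has $(u,v)$-entry the sum of $\alpha_e$ along the unique path from $u$ to $v$; $D[S]$ is the principal submatrix indexed by $S$; $\mathbf{1}\in\mathbb{R}^S$ is the all-ones vector. A spanning forest is an acyclic subgraph containing all vertices. $\mathcal{F}_1(G;S)$: spanning forests each of whose components contains exactly one vertex of $S$; for $T\in\mathcal{F}_1(G;S)$ and $v\in S$, $\operatorname{outdeg}(T,v)$ is the number of edges of $G$ with exactly one endpoint in the component of $T$ containing $v$. $\mathcal{F}_2(G;S)$: spanning forests with $|S|+1$ components, $|S|$ of which each contain exactly one vertex of $S$ and one (the floating component $F(*)$) containing none; $\operatorname{outdeg}(F,*)$ is the number of edges of $G$ with exactly one endpoint in $V(F(*))$. For a subgraph with edge set $A$, $w(A)=\prod_{e\in E\setminus A}\alpha_e$. -}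

module Defs where

open import Level using (Level)
open import Data.Bool using (Bool; true; false; _∧_; _∨_; _xor_; not; if_then_else_)
open import Data.Nat as ℕ using (ℕ; zero; suc)
open import Data.Fin using (Fin)
import Data.Fin as F
open import Data.Fin.Subset using (Subset; _∈_; inside; outside)
open import Data.Fin.Subset.Properties using (_∈?_)
open import Data.Vec using (Vec; []; _∷_)
open import Data.List using (List; []; _∷_; map; _++_; foldr)
open import Data.List.Relation.Unary.Unique.Propositional using (Unique)
open import Data.Product using (_×_; _,_; proj₁; proj₂; Σ)
open import Data.Sum using (_⊎_)
open import Relation.Binary.PropositionalEquality using (_≡_; _≢_)
open import Relation.Nullary using (Dec)
open import Relation.Nullary.Decidable using (⌊_⌋)
open import Algebra.Bundles using (CommutativeRing)

-- Finite (multi)graphs: n vertices Fin n, m edges Fin m, each edge with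
-- an (unordered) pair of endpoints.  Edge subsets are stdlib Subsets.

Graph : ℕ → ℕ → Set
Graph n m = Fin m → Fin n × Fin n

module _ {n m : ℕ} (G : Graph n m) where

  Joins : Fin m → Fin n → Fin n → Set
  Joins e u w = (G e ≡ (u , w)) ⊎ (G e ≡ (w , u))

  data Walk (A : Subset m) : Fin n → Fin n → Set where
    []   : ∀ {u} → Walk A u u
    step : ∀ {u w v} (e : Fin m) → e ∈ A → Joins e u w → Walk A w v → Walk A u v

  walkVertices : ∀ {A u v} → Walk A u v → List (Fin n)
  walkVertices {u = u} []           = u ∷ []
  walkVertices {u = u} (step _ _ _ p) = u ∷ walkVertices p

  walkEdges : ∀ {A u v} → Walk A u v → List (Fin m)
  walkEdges []             = []
  walkEdges (step e _ _ p) = e ∷ walkEdges p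

  IsPath : ∀ {A u v} → Walk A u v → Set
  IsPath p = Unique (walkVertices p)

  Acyclic : Subset m → Set
  Acyclic A = ∀ u v (p q : Walk A u v) → IsPath p → IsPath q →
              walkEdges p ≡ walkEdges q

  fullSet : Subset m
  fullSet = Data.Vec.replicate _ inside

  NoLoops : Set
  NoLoops = ∀ e → proj₁ (G e) ≢ proj₂ (G e)

  IsTree : Set
  IsTree = (0 ℕ.< n) × NoLoops × (∀ u v → Walk fullSet u v) × Acyclic fullSet

allFin : (k : ℕ) → (Fin k → Bool) → Bool
allFin zero    f = true
allFin (suc k) f = f F.zero ∧ allFin k (λ i → f (F.suc i))

anyFin : (k : ℕ) → (Fin k → Bool) → Bool
anyFin zero    f = false
anyFin (suc k) f = f F.zero ∨ anyFin k (λ i → f (F.suc i))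

countFin : (k : ℕ) → (Fin k → Bool) → ℕ
countFin zero    f = 0
countFin (suc k) f = (if f F.zero then 1 else 0) ℕ.+ countFin k (λ i → f (F.suc i))

allSubsets : (k : ℕ) → List (Subset k)
allSubsets zero    = [] ∷ []
allSubsets (suc k) = map (inside ∷_) (allSubsets k) ++ map (outside ∷_) (allSubsets k)

_∈ᵇ_ : ∀ {k} → Fin k → Subset k → Bool
i ∈ᵇ A = ⌊ i ∈? A ⌋

module RingSums {c ℓ} (R : CommutativeRing c ℓ) where
  open CommutativeRing R

  sumFin : (k : ℕ) → (Fin k → Carrier) → Carrier
  sumFin zero    f = 0#
  sumFin (suc k) f = f F.zero + sumFin k (λ i → f (F.suc i))

  prodFin : (k : ℕ) → (Fin k → Carrier) → Carrier
  prodFin zero    f = 1#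
  prodFin (suc k) f = f F.zero * prodFin k (λ i → f (F.suc i))

  sumList : ∀ {a} {A : Set a} → List A → (A → Carrier) → Carrier
  sumList xs f = foldr (λ x acc → f x + acc) 0# xs

  fromℕ : ℕ → Carrier
  fromℕ zero    = 0#
  fromℕ (suc k) = 1# + fromℕ k

  two : Carrier
  two = 1# + 1#

  module Forests {n m : ℕ} (G : Graph n m) (α : Fin m → Carrier) (S : Subset n)
                 (conn? : ∀ A u v → Dec (Walk G A u v))
                 (acyc? : ∀ A → Dec (Acyclic G A)) where

    conn : Subset m → Fin n → Fin n → Bool
    conn A u v = ⌊ conn? A u v ⌋

    acyc : Subset m → Bool
    acyc A = ⌊ acyc? A ⌋

    sCount : Subset m → Fin n → ℕ
    sCount A x = countFin n (λ s → (s ∈ᵇ S) ∧ conn A x s)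

    w : Subset m → Carrier
    w A = prodFin m (λ e → if e ∈ᵇ A then 1# else α e)

    isF₁ : Subset m → Bool
    isF₁ A = acyc A ∧ allFin n (λ x → ⌊ sCount A x ℕ.≟ 1 ⌋)

    free : Subset m → Fin n → Bool
    free A x = ⌊ sCount A x ℕ.≟ 0 ⌋

    -- F₂(G;S): spanning forests with |S|+1 components, |S| of them containing
    -- exactly one vertex of S and one (floating) component containing none
    isF₂ : Subset m → Bool
    isF₂ A = acyc A
           ∧ allFin n (λ x → ⌊ sCount A x ℕ.≤? 1 ⌋)
           ∧ anyFin n (free A)
           ∧ allFin n (λ x → allFin n (λ y → not (free A x ∧ free A y) ∨ conn A x y))

    outdeg : Subset m → Fin n → ℕ
    outdeg A v = countFin m (λ e → conn A v (proj₁ (G e)) xor conn A v (proj₂ (G e)))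

    outdeg* : Subset m → ℕ
    outdeg* A = countFin m (λ e → free A (proj₁ (G e)) xor free A (proj₂ (G e)))

    sumF₁ : (Subset m → Carrier) → Carrier
    sumF₁ f = sumList (allSubsets m) (λ A → if isF₁ A then f A else 0#)

    sumF₂ : (Subset m → Carrier) → Carrier
    sumF₂ f = sumList (allSubsets m) (λ A → if isF₂ A then f A else 0#)

    -- the vector m ∈ R^S (indexed by all vertices, only entries v ∈ S are used)
    mvec : Fin n → Carrier
    mvec v = sumF₁ (λ T → w T * (two - fromℕ (outdeg T v)))

    lam : Carrier
    lam = sumFin m α * sumF₁ w
        - sumF₂ (λ F → w F * ((two - fromℕ (outdeg* F)) * (two - fromℕ (outdeg* F))))

{-# OPTIONS --safe #-}
module Submission where

-- Fix u ∈ S and put τ x = 2 − deg x. Euler's formula |V(C)| = |E(C)| + 1 gives Σ_{x ∈ C} τ x = 2 − outdeg C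
-- for every component C of a spanning forest, so m v = Σ_T w T Σ_{x ~T v} τ x, while D u v is the sum of
-- α e over the edges e separating u from v. Exchanging sums, a forest T ∈ F₁ contributes
-- w T Σ_e α e Σ_x τ x [e separates u from the root of x in T]. The side of E ∖ e away from u has τ-sum 1,
-- which produces the first term of λ. The root of x lies on the other side of e than x exactly when e ∈ T
-- and x is in the floating component of F = T ∖ e, a forest of F₂. Writing T = F + e, so that
-- w F = α e w T, these corrections are indexed by F ∈ F₂ and the edges e leaving its floating component.
-- That component has τ-sum κ = 2 − outdeg(F,*) and exactly one of these edges separates it from u, so the
-- corrections of F add up to outdeg(F,*) κ − 2κ = −κ².

open import Defs
open import Algebra.Bundles using (CommutativeRing)
import Algebra.Properties.AbelianGroup as AbelianGroupProperties
import Algebra.Properties.CommutativeSemigroup as CommutativeSemigroupProperties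
import Algebra.Properties.Group as GroupProperties
import Algebra.Properties.Ring as RingProperties
import Algebra.Solver.CommutativeMonoid as CommutativeMonoidSolver
open import Data.Bool using (Bool; true; false; _∧_; _∨_; _xor_; not; if_then_else_)
import Data.Bool.Properties as Boolₚ
open import Data.Empty using (⊥; ⊥-elim)
open import Data.Fin as F using (Fin)
import Data.Fin.Properties as Finₚ
open import Data.Fin.Subset using (Subset; _∈_)
import Data.Fin.Subset.Properties as Subsetₚ
open import Data.List as List using (List; []; _∷_)
open import Data.List.Membership.Propositional using () renaming (_∈_ to _∈ₗ_)
import Data.List.Membership.DecPropositional as DecMembership
open import Data.List.Relation.Unary.All using ([]; _∷_)
open import Data.List.Relation.Unary.All.Properties using (¬Any⇒All¬; All¬⇒¬Any)
open import Data.List.Relation.Unary.AllPairs using ([]; _∷_)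
open import Data.List.Relation.Unary.Any using (here; there)
open import Data.List.Relation.Unary.Unique.Propositional using (Unique)
open import Data.Nat as ℕ using (ℕ; zero; suc; _≤_; s≤s)
import Data.Nat.Properties as ℕₚ
open import Data.Product using (_×_; _,_; proj₁; proj₂; Σ)
open import Data.Sum using (_⊎_; inj₁; inj₂)
open import Data.Vec using (_∷_; lookup; _[_]≔_)
import Data.Vec.Properties as Vecₚ
open import Function using (case_of_; _∘_)
open import Relation.Binary.PropositionalEquality using (_≡_; _≢_; refl; sym; trans; cong; cong₂; subst; module ≡-Reasoning)
open import Relation.Nullary using (Dec; yes; no; ¬_)
open import Relation.Nullary.Decidable using (⌊_⌋; isYes≗does; dec-true; dec-false)

true≢false : ∀ {b} → b ≡ true → b ≡ false → ⊥
true≢false refl ()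

∧≡true : ∀ {a b} → a ∧ b ≡ true → a ≡ true × b ≡ true
∧≡true {true} {true} _ = refl , refl

∨≡true : ∀ {a b} → a ∨ b ≡ true → a ≡ true ⊎ b ≡ true
∨≡true {true}  _ = inj₁ refl
∨≡true {false} h = inj₂ h

∧-intro : ∀ {a b} → a ≡ true → b ≡ true → a ∧ b ≡ true
∧-intro refl refl = refl

≡true-ext : ∀ {a b} → (a ≡ true → b ≡ true) → (b ≡ true → a ≡ true) → a ≡ b
≡true-ext {true}          f g = sym (f refl)
≡true-ext {false} {true}  f g = g refl
≡true-ext {false} {false} f g = refl

⌊⌋≡true⇒ : ∀ {p} {P : Set p} (d : Dec P) → ⌊ d ⌋ ≡ true → P
⌊⌋≡true⇒ (yes p) _ = p

⌊⌋-yes : ∀ {p} {P : Set p} (d : Dec P) → P → ⌊ d ⌋ ≡ true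
⌊⌋-yes d p = trans (isYes≗does d) (dec-true d p)

⌊⌋-no : ∀ {p} {P : Set p} (d : Dec P) → ¬ P → ⌊ d ⌋ ≡ false
⌊⌋-no d ¬p = trans (isYes≗does d) (dec-false d ¬p)

⌊≟⌋-sym : ∀ {k} (i j : Fin k) → ⌊ i Finₚ.≟ j ⌋ ≡ ⌊ j Finₚ.≟ i ⌋
⌊≟⌋-sym i j = ≡true-ext (λ h → ⌊⌋-yes (j Finₚ.≟ i) (sym (⌊⌋≡true⇒ (i Finₚ.≟ j) h)))
                        (λ h → ⌊⌋-yes (i Finₚ.≟ j) (sym (⌊⌋≡true⇒ (j Finₚ.≟ i) h)))

⌊≟⌋-suc : ∀ {k} (i j : Fin k) → ⌊ F.suc i Finₚ.≟ F.suc j ⌋ ≡ ⌊ i Finₚ.≟ j ⌋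
⌊≟⌋-suc i j with i Finₚ.≟ j
... | yes _ = refl
... | no  _ = refl

countFin-cong : ∀ k {p q : Fin k → Bool} → (∀ i → p i ≡ q i) → countFin k p ≡ countFin k q
countFin-cong zero    h = refl
countFin-cong (suc k) h rewrite h F.zero = cong (_ ℕ.+_) (countFin-cong k (λ i → h (F.suc i)))

countFin-false : ∀ k → countFin k (λ _ → false) ≡ 0
countFin-false zero    = refl
countFin-false (suc k) = countFin-false k

countFin-∨ : ∀ k (p q : Fin k → Bool) → (∀ i → p i ∧ q i ≡ false) →
             countFin k (λ i → p i ∨ q i) ≡ countFin k p ℕ.+ countFin k q
countFin-∨ zero    p q h = refl
countFin-∨ (suc k) p q h with p F.zero in p₀ | q F.zero in q₀
... | true  | true  = ⊥-elim (true≢false (cong₂ _∧_ p₀ q₀) (h F.zero))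
... | true  | false = cong suc (countFin-∨ k _ _ (λ i → h (F.suc i)))
... | false | true  = trans (cong suc (countFin-∨ k _ _ (λ i → h (F.suc i)))) (sym (ℕₚ.+-suc _ _))
... | false | false = countFin-∨ k _ _ (λ i → h (F.suc i))

countFin-≟ : ∀ k (j : Fin k) → countFin k (λ i → ⌊ i Finₚ.≟ j ⌋) ≡ 1
countFin-≟ (suc k) F.zero    = cong suc (countFin-false k)
countFin-≟ (suc k) (F.suc j) = trans (countFin-cong k (λ i → ⌊≟⌋-suc i j)) (countFin-≟ k j)

countFin-≟-∧ : ∀ k (j : Fin k) (q : Fin k → Bool) →
               countFin k (λ i → ⌊ i Finₚ.≟ j ⌋ ∧ q i) ≡ (if q j then 1 else 0)
countFin-≟-∧ k j q with q j in qj
... | true  = trans (countFin-cong k pick) (countFin-≟ k j)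
  where pick : ∀ i → ⌊ i Finₚ.≟ j ⌋ ∧ q i ≡ ⌊ i Finₚ.≟ j ⌋
        pick i with i Finₚ.≟ j
        ... | yes refl = qj
        ... | no  _    = refl
... | false = trans (countFin-cong k pick) (countFin-false k)
  where pick : ∀ i → ⌊ i Finₚ.≟ j ⌋ ∧ q i ≡ false
        pick i with i Finₚ.≟ j
        ... | yes refl = qj
        ... | no  _    = refl

countFin-split : ∀ k (p q r : Fin k → Bool) → (∀ i → p i ≡ q i ∨ r i) → (∀ i → q i ∧ r i ≡ false) →
                 ∀ (t : Fin k → Bool) →
                 countFin k (λ i → p i ∧ t i) ≡ countFin k (λ i → q i ∧ t i) ℕ.+ countFin k (λ i → r i ∧ t i)
countFin-split k p q r p≡q∨r q∧r≡false t =
  trans (countFin-cong k distrib) (countFin-∨ k _ _ disjoint)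
  where
  distrib : ∀ i → p i ∧ t i ≡ (q i ∧ t i) ∨ (r i ∧ t i)
  distrib i rewrite p≡q∨r i = Boolₚ.∧-distribʳ-∨ (t i) (q i) (r i)
  disjoint : ∀ i → (q i ∧ t i) ∧ (r i ∧ t i) ≡ false
  disjoint i with q i in qi | r i in ri
  ... | true  | true  = ⊥-elim (true≢false (cong₂ _∧_ qi ri) (q∧r≡false i))
  ... | true  | false = Boolₚ.∧-zeroʳ (t i)
  ... | false | _     = refl

countFin≡0⇒ : ∀ k (p : Fin k → Bool) → countFin k p ≡ 0 → ∀ i → p i ≡ false
countFin≡0⇒ (suc k) p h i with p F.zero in p₀
countFin≡0⇒ (suc k) p h F.zero    | false = p₀
countFin≡0⇒ (suc k) p h (F.suc i) | false = countFin≡0⇒ k _ h i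

countFin≡suc⇒ : ∀ k (p : Fin k → Bool) {r} → countFin k p ≡ suc r → Σ (Fin k) (λ i → p i ≡ true)
countFin≡suc⇒ (suc k) p h with p F.zero in p₀
... | true  = F.zero , p₀
... | false = let i , pi = countFin≡suc⇒ k _ h in F.suc i , pi

countFin-mono : ∀ k (p q : Fin k → Bool) → (∀ i → p i ≡ true → q i ≡ true) → countFin k p ≤ countFin k q
countFin-mono zero    p q h = ℕ.z≤n
countFin-mono (suc k) p q h with p F.zero in p₀ | q F.zero in q₀
... | true  | true  = s≤s (countFin-mono k _ _ (λ i → h (F.suc i)))
... | true  | false = ⊥-elim (true≢false (h F.zero p₀) q₀)
... | false | true  = ℕₚ.m≤n⇒m≤1+n (countFin-mono k _ _ (λ i → h (F.suc i)))
... | false | false = countFin-mono k _ _ (λ i → h (F.suc i))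

countFin≡1⇒unique : ∀ k (p : Fin k → Bool) → countFin k p ≡ 1 →
                    ∀ {s t} → p s ≡ true → p t ≡ true → s ≡ t
countFin≡1⇒unique k p h {s} {t} ps pt with s Finₚ.≟ t
... | yes s≡t = s≡t
... | no  s≢t = case ℕₚ.≤-trans two≤count (ℕₚ.≤-reflexive h) of λ { (s≤s ()) }
  where
  s-or-t : ∀ i → ⌊ i Finₚ.≟ s ⌋ ∨ ⌊ i Finₚ.≟ t ⌋ ≡ true → p i ≡ true
  s-or-t i eq with i Finₚ.≟ s | i Finₚ.≟ t
  ... | yes refl | _        = ps
  ... | no  _    | yes refl = pt
  not-both : ∀ i → ⌊ i Finₚ.≟ s ⌋ ∧ ⌊ i Finₚ.≟ t ⌋ ≡ false
  not-both i with i Finₚ.≟ s | i Finₚ.≟ t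
  ... | yes refl | yes refl = ⊥-elim (s≢t refl)
  ... | yes _    | no  _    = refl
  ... | no  _    | _        = refl
  two≤count : 2 ≤ countFin k p
  two≤count = begin
    2                                                               ≡⟨ cong₂ ℕ._+_ (countFin-≟ k s) (countFin-≟ k t) ⟨
    countFin k (λ i → ⌊ i Finₚ.≟ s ⌋) ℕ.+ countFin k (λ i → ⌊ i Finₚ.≟ t ⌋) ≡⟨ countFin-∨ k _ _ not-both ⟨
    countFin k (λ i → ⌊ i Finₚ.≟ s ⌋ ∨ ⌊ i Finₚ.≟ t ⌋)                 ≤⟨ countFin-mono k _ _ s-or-t ⟩
    countFin k p                                                    ∎
    where open ℕₚ.≤-Reasoning

countList : ∀ {a} {A : Set a} → (A → Bool) → List A → ℕ
countList p []       = 0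
countList p (x ∷ xs) = (if p x then 1 else 0) ℕ.+ countList p xs

countList≡0 : ∀ {a} {A : Set a} (p : A → Bool) (xs : List A) → (∀ {x} → x ∈ₗ xs → p x ≡ false) → countList p xs ≡ 0
countList≡0 p []       h = refl
countList≡0 p (x ∷ xs) h rewrite h (here refl) = countList≡0 p xs (λ x∈xs → h (there x∈xs))

module _ {k : ℕ} where
  open DecMembership (Finₚ._≟_ {k}) using (_∈?_)

  countFin-Unique : ∀ (p : Fin k → Bool) (xs : List (Fin k)) → Unique xs →
                    countFin k (λ i → p i ∧ ⌊ i ∈? xs ⌋) ≡ countList p xs
  countFin-Unique p [] _ = trans (countFin-cong k (λ i → Boolₚ.∧-zeroʳ (p i))) (countFin-false k)
  countFin-Unique p (x ∷ xs) (x∉xs ∷ xs-unique) = begin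
    countFin k (λ i → p i ∧ ⌊ i ∈? (x ∷ xs) ⌋)
      ≡⟨ countFin-cong k (λ i → Boolₚ.∧-comm (p i) _) ⟩
    countFin k (λ i → ⌊ i ∈? (x ∷ xs) ⌋ ∧ p i)
      ≡⟨ countFin-split k _ (λ i → ⌊ i Finₚ.≟ x ⌋) (λ i → ⌊ i ∈? xs ⌋) cons disjoint p ⟩
    countFin k (λ i → ⌊ i Finₚ.≟ x ⌋ ∧ p i) ℕ.+ countFin k (λ i → ⌊ i ∈? xs ⌋ ∧ p i)
      ≡⟨ cong₂ ℕ._+_ (countFin-≟-∧ k x p) (countFin-cong k (λ i → Boolₚ.∧-comm _ (p i))) ⟩
    (if p x then 1 else 0) ℕ.+ countFin k (λ i → p i ∧ ⌊ i ∈? xs ⌋)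
      ≡⟨ cong (_ ℕ.+_) (countFin-Unique p xs xs-unique) ⟩
    countList p (x ∷ xs) ∎
    where
    open ≡-Reasoning
    cons : ∀ i → ⌊ i ∈? (x ∷ xs) ⌋ ≡ ⌊ i Finₚ.≟ x ⌋ ∨ ⌊ i ∈? xs ⌋
    cons i with i Finₚ.≟ x | i ∈? xs
    ... | yes _ | _     = refl
    ... | no  _ | yes _ = refl
    ... | no  _ | no  _ = refl
    disjoint : ∀ i → ⌊ i Finₚ.≟ x ⌋ ∧ ⌊ i ∈? xs ⌋ ≡ false
    disjoint i with i Finₚ.≟ x | i ∈? xs
    ... | yes refl | yes x∈xs = ⊥-elim (All¬⇒¬Any x∉xs x∈xs)
    ... | yes _    | no  _    = refl
    ... | no  _    | _        = refl

allFin-sound : ∀ k (f : Fin k → Bool) → allFin k f ≡ true → ∀ i → f i ≡ true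
allFin-sound (suc k) f h F.zero    = proj₁ (∧≡true h)
allFin-sound (suc k) f h (F.suc i) = allFin-sound k _ (proj₂ (∧≡true {f F.zero} h)) i

allFin-complete : ∀ k (f : Fin k → Bool) → (∀ i → f i ≡ true) → allFin k f ≡ true
allFin-complete zero    f h = refl
allFin-complete (suc k) f h rewrite h F.zero = allFin-complete k _ (λ i → h (F.suc i))

anyFin-sound : ∀ k (f : Fin k → Bool) → anyFin k f ≡ true → Σ (Fin k) (λ i → f i ≡ true)
anyFin-sound (suc k) f h with f F.zero in f₀
... | true  = F.zero , f₀
... | false = let i , fi = anyFin-sound k _ h in F.suc i , fi

anyFin-complete : ∀ k (f : Fin k → Bool) i → f i ≡ true → anyFin k f ≡ true
anyFin-complete (suc k) f F.zero    h rewrite h = refl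
anyFin-complete (suc k) f (F.suc i) h with f F.zero
... | true  = refl
... | false = anyFin-complete k _ i h

∈⇒lookup : ∀ {k} {i : Fin k} {A : Subset k} → i ∈ A → lookup A i ≡ true
∈⇒lookup = Vecₚ.[]=⇒lookup

lookup⇒∈ : ∀ {k} {i : Fin k} {A : Subset k} → lookup A i ≡ true → i ∈ A
lookup⇒∈ {i = i} {A} = Vecₚ.lookup⇒[]= i A

∈ᵇ≡lookup : ∀ {k} (i : Fin k) (A : Subset k) → i ∈ᵇ A ≡ lookup A i
∈ᵇ≡lookup i A with i Subsetₚ.∈? A
... | yes i∈A = sym (∈⇒lookup i∈A)
... | no  i∉A with lookup A i in Ai
...   | true  = ⊥-elim (i∉A (lookup⇒∈ Ai))
...   | false = refl

lookup-update : ∀ {k} (A : Subset k) (e i : Fin k) b →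
                lookup (A [ e ]≔ b) i ≡ (if ⌊ i Finₚ.≟ e ⌋ then b else lookup A i)
lookup-update A e i b with i Finₚ.≟ e
... | yes refl = Vecₚ.lookup∘update i A b
... | no  i≢e  = Vecₚ.lookup∘update′ i≢e A b

∈-update⁻ : ∀ {k} {A : Subset k} {e i : Fin k} {b} → i ∈ (A [ e ]≔ b) → (i ≡ e × b ≡ true) ⊎ (i ≢ e × i ∈ A)
∈-update⁻ {A = A} {e} {i} {b} h with i Finₚ.≟ e
... | yes refl = inj₁ (refl , trans (sym (Vecₚ.lookup∘update i A b)) (∈⇒lookup h))
... | no  i≢e  = inj₂ (i≢e , lookup⇒∈ (trans (sym (Vecₚ.lookup∘update′ i≢e A b)) (∈⇒lookup h)))

∈-update-self : ∀ {k} (A : Subset k) (e : Fin k) → e ∈ (A [ e ]≔ true)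
∈-update-self A e = lookup⇒∈ (Vecₚ.lookup∘update e A true)

∈-update⁺ : ∀ {k} {A : Subset k} {e i : Fin k} {b} → i ≢ e → i ∈ A → i ∈ (A [ e ]≔ b)
∈-update⁺ {A = A} {b = b} i≢e h = lookup⇒∈ (trans (Vecₚ.lookup∘update′ i≢e A b) (∈⇒lookup h))

∉-update-false : ∀ {k} (A : Subset k) (e : Fin k) → ¬ (e ∈ (A [ e ]≔ false))
∉-update-false A e h with ∈-update⁻ h
... | inj₁ (_ , ())
... | inj₂ (e≢e , _) = e≢e refl

module _ {n m : ℕ} {G : Graph n m} where

  Joins-sym : ∀ {e u w} → Joins G e u w → Joins G e w u
  Joins-sym (inj₁ p) = inj₂ p
  Joins-sym (inj₂ p) = inj₁ p

  edgeWalk : ∀ {A} e → e ∈ A → Walk G A (proj₁ (G e)) (proj₂ (G e))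
  edgeWalk e e∈A = step e e∈A (inj₁ refl) []

  infixr 5 _++ʷ_
  _++ʷ_ : ∀ {A u v w} → Walk G A u v → Walk G A v w → Walk G A u w
  []             ++ʷ q = q
  step e i j p   ++ʷ q = step e i j (p ++ʷ q)

  reverseʷ : ∀ {A u v} → Walk G A u v → Walk G A v u
  reverseʷ []             = []
  reverseʷ (step e i j p) = reverseʷ p ++ʷ step e i (Joins-sym j) []

  weaken : ∀ {A B u v} → (∀ {e} → e ∈ A → e ∈ B) → Walk G A u v → Walk G B u v
  weaken A⊆B []             = []
  weaken A⊆B (step e i j p) = step e (A⊆B i) j (weaken A⊆B p)

  walkVertices-weaken : ∀ {A B u v} (A⊆B : ∀ {e} → e ∈ A → e ∈ B) (p : Walk G A u v) →
                        walkVertices G (weaken A⊆B p) ≡ walkVertices G p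
  walkVertices-weaken A⊆B []             = refl
  walkVertices-weaken A⊆B (step e i j p) = cong (_ ∷_) (walkVertices-weaken A⊆B p)

  walkEdges-weaken : ∀ {A B u v} (A⊆B : ∀ {e} → e ∈ A → e ∈ B) (p : Walk G A u v) →
                     walkEdges G (weaken A⊆B p) ≡ walkEdges G p
  walkEdges-weaken A⊆B []             = refl
  walkEdges-weaken A⊆B (step e i j p) = cong (e ∷_) (walkEdges-weaken A⊆B p)

  IsPath-weaken : ∀ {A B u v} (A⊆B : ∀ {e} → e ∈ A → e ∈ B) (p : Walk G A u v) →
                  IsPath G p → IsPath G (weaken A⊆B p)
  IsPath-weaken A⊆B p p-path rewrite walkVertices-weaken A⊆B p = p-path

  restrict : ∀ {A B u v} (p : Walk G A u v) → (∀ {e} → e ∈ₗ walkEdges G p → e ∈ B) → Walk G B u v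
  restrict []             p⊆B = []
  restrict (step e i j p) p⊆B = step e (p⊆B (here refl)) j (restrict p (λ h → p⊆B (there h)))

  walkEdges⊆ : ∀ {A u v} (p : Walk G A u v) {e} → e ∈ₗ walkEdges G p → e ∈ A
  walkEdges⊆ (step e i j p) (here refl) = i
  walkEdges⊆ (step e i j p) (there h)   = walkEdges⊆ p h

  head∈walkVertices : ∀ {A u v} (p : Walk G A u v) → u ∈ₗ walkVertices G p
  head∈walkVertices []               = here refl
  head∈walkVertices (step _ _ _ _)   = here refl

  ends∈walkVertices : ∀ {A u v} (p : Walk G A u v) {e} → e ∈ₗ walkEdges G p →
                      proj₁ (G e) ∈ₗ walkVertices G p × proj₂ (G e) ∈ₗ walkVertices G p
  ends∈walkVertices (step e i (inj₁ eq) p) (here refl) rewrite eq = here refl , there (head∈walkVertices p)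
  ends∈walkVertices (step e i (inj₂ eq) p) (here refl) rewrite eq = there (head∈walkVertices p) , here refl
  ends∈walkVertices (step e i j p) (there h) =
    let a , b = ends∈walkVertices p h in there a , there b

  path⇒walkEdges-unique : ∀ {A u v} (p : Walk G A u v) → IsPath G p → Unique (walkEdges G p)
  path⇒walkEdges-unique []                        _          = []
  path⇒walkEdges-unique {u = u} (step e i j p) (u∉p ∷ p-path) =
    ¬Any⇒All¬ _ (e∉p j) ∷ path⇒walkEdges-unique p p-path
    where
    e∉p : ∀ {w} → Joins G e u w → ¬ (e ∈ₗ walkEdges G p)
    e∉p (inj₁ eq) h = All¬⇒¬Any u∉p (subst (_∈ₗ _) (cong proj₁ eq) (proj₁ (ends∈walkVertices p h)))
    e∉p (inj₂ eq) h = All¬⇒¬Any u∉p (subst (_∈ₗ _) (cong proj₂ eq) (proj₂ (ends∈walkVertices p h)))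

  suffixFrom : ∀ {A x w y} (q : Walk G A w y) → x ∈ₗ walkVertices G q →
               Σ (Walk G A x y) (λ r → IsPath G q → IsPath G r)
  suffixFrom []                 (here refl) = [] , λ _ → [] ∷ []
  suffixFrom q@(step _ _ _ _)   (here refl) = q , λ q-path → q-path
  suffixFrom (step f i j q)     (there h)   =
    let r , r-path = suffixFrom q h in r , λ { (_ ∷ q-path) → r-path q-path }

  toPath : ∀ {A x y} → Walk G A x y → Σ (Walk G A x y) (IsPath G)
  toPath [] = [] , ([] ∷ [])
  toPath {x = x} (step e i j p) with toPath p
  ... | q , q-path with DecMembership._∈?_ Finₚ._≟_ x (walkVertices G q)
  ...   | yes x∈q = proj₁ (suffixFrom q x∈q) , proj₂ (suffixFrom q x∈q) q-path
  ...   | no  x∉q = step e i j q , (¬Any⇒All¬ _ x∉q ∷ q-path)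

  WalkVia : Subset m → Fin m → Fin n → Fin n → Set
  WalkVia A e x y = Walk G A x y
                  ⊎ (Walk G A x (proj₁ (G e)) × Walk G A (proj₂ (G e)) y)
                  ⊎ (Walk G A x (proj₂ (G e)) × Walk G A (proj₁ (G e)) y)

  splitAt : ∀ {A B} e → (∀ {f} → f ∈ B → f ≡ e ⊎ f ∈ A) → ∀ {x y} → Walk G B x y → WalkVia A e x y
  splitAt e B⊆A+e [] = inj₁ []
  splitAt {A} e B⊆A+e {x} {y} (step f i j p) with B⊆A+e i | splitAt e B⊆A+e p
  ... | inj₂ f∈A | inj₁ q               = inj₁ (step f f∈A j q)
  ... | inj₂ f∈A | inj₂ (inj₁ (q , r))  = inj₂ (inj₁ (step f f∈A j q , r))
  ... | inj₂ f∈A | inj₂ (inj₂ (q , r))  = inj₂ (inj₂ (step f f∈A j q , r))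
  ... | inj₁ refl | rest                = traverse j rest
    where
    traverse : ∀ {w} → Joins G f x w → WalkVia A f w y → WalkVia A f x y
    traverse (inj₁ refl) (inj₁ q)             = inj₂ (inj₁ ([] , q))
    traverse (inj₁ refl) (inj₂ (inj₁ (_ , r))) = inj₂ (inj₁ ([] , r))
    traverse (inj₁ refl) (inj₂ (inj₂ (_ , r))) = inj₁ r
    traverse (inj₂ refl) (inj₁ q)             = inj₂ (inj₂ ([] , q))
    traverse (inj₂ refl) (inj₂ (inj₁ (_ , r))) = inj₁ r
    traverse (inj₂ refl) (inj₂ (inj₂ (_ , r))) = inj₂ (inj₂ ([] , r))

module RingSumProperties {c ℓ} (R : CommutativeRing c ℓ) where
  open CommutativeRing R renaming (refl to ≈-refl; sym to ≈-sym; trans to ≈-trans)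
  open RingSums R
  open RingProperties ring using (-‿distribˡ-*; [y-z]x≈yx-zx)
  open AbelianGroupProperties +-abelianGroup using (⁻¹-∙-comm; ⁻¹-anti-homo‿-)
  open GroupProperties +-group using (ε⁻¹≈ε)
  open import Relation.Binary.Reasoning.Setoid setoid

  [_] : Bool → Carrier
  [ b ] = if b then 1# else 0#

  if-then-0≈[]* : ∀ b x → (if b then x else 0#) ≈ [ b ] * x
  if-then-0≈[]* true  x = ≈-sym (*-identityˡ x)
  if-then-0≈[]* false x = ≈-sym (zeroˡ x)

  [∧]≈[]*[] : ∀ a b → [ a ∧ b ] ≈ [ a ] * [ b ]
  [∧]≈[]*[] true  b = ≈-sym (*-identityˡ _)
  [∧]≈[]*[] false b = ≈-sym (zeroˡ _)

  []-cong : ∀ {a b} → a ≡ b → ∀ x → [ a ] * x ≈ [ b ] * x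
  []-cong refl x = ≈-refl

  x+z≈y⇒x≈y-z : ∀ {x y z} → x + z ≈ y → x ≈ y - z
  x+z≈y⇒x≈y-z {x} {y} {z} h = begin
    x              ≈⟨ +-identityʳ x ⟨
    x + 0#         ≈⟨ +-congˡ (-‿inverseʳ z) ⟨
    x + (z - z)    ≈⟨ +-assoc _ _ _ ⟨
    (x + z) - z    ≈⟨ +-congʳ h ⟩
    y - z          ∎

  [a+b]-[b+c]≈a-c : ∀ a b c → (a + b) - (b + c) ≈ a - c
  [a+b]-[b+c]≈a-c a b c = ≈-sym (x+z≈y⇒x≈y-z (begin
    (a - c) + (b + c)     ≈⟨ +-assoc a (- c) (b + c) ⟩
    a + (- c + (b + c))   ≈⟨ +-congˡ (+-congˡ (+-comm b c)) ⟩
    a + (- c + (c + b))   ≈⟨ +-congˡ (+-assoc (- c) c b) ⟨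
    a + ((- c + c) + b)   ≈⟨ +-congˡ (+-congʳ (-‿inverseˡ c)) ⟩
    a + (0# + b)          ≈⟨ +-congˡ (+-identityˡ b) ⟩
    a + b                 ∎))

  two-1≈1 : two - fromℕ 1 ≈ 1#
  two-1≈1 = ≈-trans ([a+b]-[b+c]≈a-c 1# 1# 0#) (≈-trans (+-congˡ ε⁻¹≈ε) (+-identityʳ 1#))

  [xor]≈[]+[]-2[∧] : ∀ a b → [ a xor b ] ≈ ([ b ] + [ a ]) - two * [ a ∧ b ]
  [xor]≈[]+[]-2[∧] a b = x+z≈y⇒x≈y-z (bits a b)
    where
    bits : ∀ a b → [ a xor b ] + two * [ a ∧ b ] ≈ [ b ] + [ a ]
    bits true  true  = ≈-trans (+-identityˡ _) (*-identityʳ two)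
    bits true  false = ≈-trans (+-congˡ (zeroʳ two)) (≈-trans (+-identityʳ _) (≈-sym (+-identityˡ _)))
    bits false true  = ≈-trans (+-congˡ (zeroʳ two)) (≈-trans (+-identityʳ _) (≈-sym (+-identityʳ _)))
    bits false false = +-congˡ (zeroʳ two)

  []+[]≈2[∧]+[xor] : ∀ a b → [ a ] + [ b ] ≈ two * [ a ∧ b ] + [ a xor b ]
  []+[]≈2[∧]+[xor] true  true  = ≈-trans (≈-sym (*-identityʳ two)) (≈-sym (+-identityʳ _))
  []+[]≈2[∧]+[xor] true  false = ≈-trans (+-identityʳ _) (≈-sym (≈-trans (+-congʳ (zeroʳ two)) (+-identityˡ _)))
  []+[]≈2[∧]+[xor] false true  = ≈-trans (+-identityˡ _) (≈-sym (≈-trans (+-congʳ (zeroʳ two)) (+-identityˡ _)))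
  []+[]≈2[∧]+[xor] false false = ≈-trans (+-identityˡ _) (≈-sym (≈-trans (+-identityʳ _) (zeroʳ two)))

  x[y-x]-y[y-x]≈-[y-x]² : ∀ x y → x * (y - x) - y * (y - x) ≈ - ((y - x) * (y - x))
  x[y-x]-y[y-x]≈-[y-x]² x y = begin
    x * (y - x) - y * (y - x)   ≈⟨ [y-z]x≈yx-zx (y - x) x y ⟨
    (x - y) * (y - x)           ≈⟨ *-congʳ (⁻¹-anti-homo‿- y x) ⟨
    - (y - x) * (y - x)         ≈⟨ -‿distribˡ-* (y - x) (y - x) ⟨
    - ((y - x) * (y - x))       ∎

  fromℕ-countFin : ∀ k (p : Fin k → Bool) → fromℕ (countFin k p) ≈ sumFin k (λ i → [ p i ])
  fromℕ-countFin zero    p = ≈-refl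
  fromℕ-countFin (suc k) p with p F.zero
  ... | true  = +-congˡ (fromℕ-countFin k _)
  ... | false = ≈-trans (fromℕ-countFin k _) (≈-sym (+-identityˡ _))

  sumFin-cong : ∀ k {f g : Fin k → Carrier} → (∀ i → f i ≈ g i) → sumFin k f ≈ sumFin k g
  sumFin-cong zero    h = ≈-refl
  sumFin-cong (suc k) h = +-cong (h F.zero) (sumFin-cong k (λ i → h (F.suc i)))

  sumFin-0 : ∀ k → sumFin k (λ _ → 0#) ≈ 0#
  sumFin-0 zero    = ≈-refl
  sumFin-0 (suc k) = ≈-trans (+-identityˡ _) (sumFin-0 k)

  sumFin-+ : ∀ k (f g : Fin k → Carrier) → sumFin k (λ i → f i + g i) ≈ sumFin k f + sumFin k g
  sumFin-+ zero    f g = ≈-sym (+-identityˡ 0#)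
  sumFin-+ (suc k) f g = ≈-trans (+-congˡ (sumFin-+ k _ _)) (CommutativeSemigroupProperties.interchange +-commutativeSemigroup _ _ _ _)

  sumFin-neg : ∀ k (f : Fin k → Carrier) → sumFin k (λ i → - f i) ≈ - sumFin k f
  sumFin-neg zero    f = ≈-sym ε⁻¹≈ε
  sumFin-neg (suc k) f = ≈-trans (+-congˡ (sumFin-neg k _)) (⁻¹-∙-comm _ _)

  sumFin-minus : ∀ k (f g : Fin k → Carrier) → sumFin k (λ i → f i - g i) ≈ sumFin k f - sumFin k g
  sumFin-minus k f g = ≈-trans (sumFin-+ k _ _) (+-congˡ (sumFin-neg k g))

  *-distribˡ-sumFin : ∀ k x (f : Fin k → Carrier) → x * sumFin k f ≈ sumFin k (λ i → x * f i)
  *-distribˡ-sumFin zero    x f = zeroʳ x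
  *-distribˡ-sumFin (suc k) x f = ≈-trans (distribˡ x _ _) (+-congˡ (*-distribˡ-sumFin k x _))

  *-distribʳ-sumFin : ∀ k x (f : Fin k → Carrier) → sumFin k f * x ≈ sumFin k (λ i → f i * x)
  *-distribʳ-sumFin k x f = ≈-trans (*-comm _ x) (≈-trans (*-distribˡ-sumFin k x f) (sumFin-cong k (λ i → *-comm x (f i))))

  *-sumFin-*-sumFin : ∀ k l x (f : Fin k → Carrier) (g : Fin l → Carrier) →
                      x * (sumFin k f * sumFin l g) ≈ sumFin k (λ i → sumFin l (λ j → x * (f i * g j)))
  *-sumFin-*-sumFin k l x f g = begin
    x * (sumFin k f * sumFin l g)                              ≈⟨ *-congˡ (*-distribʳ-sumFin k _ f) ⟩
    x * sumFin k (λ i → f i * sumFin l g)                      ≈⟨ *-distribˡ-sumFin k x _ ⟩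
    sumFin k (λ i → x * (f i * sumFin l g))                    ≈⟨ sumFin-cong k (λ i → *-congˡ (*-distribˡ-sumFin l (f i) g)) ⟩
    sumFin k (λ i → x * sumFin l (λ j → f i * g j))            ≈⟨ sumFin-cong k (λ i → *-distribˡ-sumFin l x _) ⟩
    sumFin k (λ i → sumFin l (λ j → x * (f i * g j)))          ∎

  sumFin-swap : ∀ a b (f : Fin a → Fin b → Carrier) →
                sumFin a (λ i → sumFin b (f i)) ≈ sumFin b (λ j → sumFin a (λ i → f i j))
  sumFin-swap zero    b f = ≈-sym (sumFin-0 b)
  sumFin-swap (suc a) b f = ≈-trans (+-congˡ (sumFin-swap a b _)) (≈-sym (sumFin-+ b _ _))

  sumFin-[≟] : ∀ k (j : Fin k) (f : Fin k → Carrier) → sumFin k (λ i → [ ⌊ i Finₚ.≟ j ⌋ ] * f i) ≈ f j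
  sumFin-[≟] (suc k) F.zero f =
    ≈-trans (+-cong (*-identityˡ _) (≈-trans (sumFin-cong k (λ i → zeroˡ _)) (sumFin-0 k))) (+-identityʳ _)
  sumFin-[≟] (suc k) (F.suc j) f =
    ≈-trans (+-cong (zeroˡ _) (≈-trans (sumFin-cong k (λ i → []-cong (⌊≟⌋-suc i j) _)) (sumFin-[≟] k j _)))
          (+-identityˡ _)

  sumFin-[]*[≟] : ∀ k (p : Fin k → Bool) j → sumFin k (λ i → [ p i ] * [ ⌊ j Finₚ.≟ i ⌋ ]) ≈ [ p j ]
  sumFin-[]*[≟] k p j = ≈-trans (sumFin-cong k (λ i → ≈-trans (*-comm _ _) ([]-cong (⌊≟⌋-sym j i) _)))
                                (sumFin-[≟] k j (λ i → [ p i ]))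

  sumFin-unique : ∀ k (p : Fin k → Bool) (g : Fin k → Carrier) s → countFin k p ≡ 1 → p s ≡ true →
                  sumFin k (λ i → [ p i ] * g i) ≈ g s
  sumFin-unique k p g s p-once ps = ≈-trans (sumFin-cong k (λ i → []-cong (p≡[≟s] i) _)) (sumFin-[≟] k s g)
    where
    p≡[≟s] : ∀ i → p i ≡ ⌊ i Finₚ.≟ s ⌋
    p≡[≟s] i with i Finₚ.≟ s
    ... | yes refl = ps
    ... | no  i≢s with p i in pi
    ...   | true  = ⊥-elim (i≢s (countFin≡1⇒unique k p p-once pi ps))
    ...   | false = refl

  sumList-cong : ∀ {a} {A : Set a} (xs : List A) {f g : A → Carrier} → (∀ x → f x ≈ g x) →
                 sumList xs f ≈ sumList xs g
  sumList-cong []       h = ≈-refl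
  sumList-cong (x ∷ xs) h = +-cong (h x) (sumList-cong xs h)

  sumList-+ : ∀ {a} {A : Set a} (xs : List A) (f g : A → Carrier) →
              sumList xs (λ x → f x + g x) ≈ sumList xs f + sumList xs g
  sumList-+ []       f g = ≈-sym (+-identityˡ 0#)
  sumList-+ (x ∷ xs) f g = ≈-trans (+-congˡ (sumList-+ xs _ _)) (CommutativeSemigroupProperties.interchange +-commutativeSemigroup _ _ _ _)

  sumList-neg : ∀ {a} {A : Set a} (xs : List A) (f : A → Carrier) → sumList xs (λ x → - f x) ≈ - sumList xs f
  sumList-neg []       f = ≈-sym ε⁻¹≈ε
  sumList-neg (x ∷ xs) f = ≈-trans (+-congˡ (sumList-neg xs _)) (⁻¹-∙-comm _ _)

  *-distribˡ-sumList : ∀ {a} {A : Set a} (xs : List A) y (f : A → Carrier) →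
                       y * sumList xs f ≈ sumList xs (λ x → y * f x)
  *-distribˡ-sumList []       y f = zeroʳ y
  *-distribˡ-sumList (x ∷ xs) y f = ≈-trans (distribˡ y _ _) (+-congˡ (*-distribˡ-sumList xs y _))

  sumList-sumFin-swap : ∀ {a} {A : Set a} (xs : List A) k (f : A → Fin k → Carrier) →
                        sumList xs (λ x → sumFin k (f x)) ≈ sumFin k (λ j → sumList xs (λ x → f x j))
  sumList-sumFin-swap []       k f = ≈-sym (sumFin-0 k)
  sumList-sumFin-swap (x ∷ xs) k f = ≈-trans (+-congˡ (sumList-sumFin-swap xs k _)) (≈-sym (sumFin-+ k _ _))

  sumList-++ : ∀ {a} {A : Set a} (xs ys : List A) f → sumList (xs List.++ ys) f ≈ sumList xs f + sumList ys f
  sumList-++ []       ys f = ≈-sym (+-identityˡ _)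
  sumList-++ (x ∷ xs) ys f = ≈-trans (+-congˡ (sumList-++ xs ys f)) (≈-sym (+-assoc _ _ _))

  sumList-map : ∀ {a b} {A : Set a} {B : Set b} (g : A → B) (xs : List A) f →
                sumList (List.map g xs) f ≈ sumList xs (λ x → f (g x))
  sumList-map g []       f = ≈-refl
  sumList-map g (x ∷ xs) f = +-congˡ (sumList-map g xs f)

  module _ {k : ℕ} where
    open DecMembership (Finₚ._≟_ {k}) using (_∈?_)

    sumList-Unique : (xs : List (Fin k)) → Unique xs → (f : Fin k → Carrier) →
                     sumList xs f ≈ sumFin k (λ e → [ ⌊ e ∈? xs ⌋ ] * f e)
    sumList-Unique [] _ f = ≈-sym (≈-trans (sumFin-cong k (λ _ → zeroˡ _)) (sumFin-0 k))
    sumList-Unique (x ∷ xs) (x∉xs ∷ xs-unique) f = begin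
      f x + sumList xs f
        ≈⟨ +-cong (≈-sym (sumFin-[≟] k x f)) (sumList-Unique xs xs-unique f) ⟩
      sumFin k (λ e → [ ⌊ e Finₚ.≟ x ⌋ ] * f e) + sumFin k (λ e → [ ⌊ e ∈? xs ⌋ ] * f e)
        ≈⟨ sumFin-+ k _ _ ⟨
      sumFin k (λ e → [ ⌊ e Finₚ.≟ x ⌋ ] * f e + [ ⌊ e ∈? xs ⌋ ] * f e)
        ≈⟨ sumFin-cong k cons ⟩
      sumFin k (λ e → [ ⌊ e ∈? (x ∷ xs) ⌋ ] * f e) ∎
      where
      cons : ∀ e → [ ⌊ e Finₚ.≟ x ⌋ ] * f e + [ ⌊ e ∈? xs ⌋ ] * f e ≈ [ ⌊ e ∈? (x ∷ xs) ⌋ ] * f e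
      cons e with e Finₚ.≟ x | e ∈? xs
      ... | yes refl | yes x∈xs = ⊥-elim (All¬⇒¬Any x∉xs x∈xs)
      ... | yes refl | no  _    = ≈-trans (+-congˡ (zeroˡ _)) (+-identityʳ _)
      ... | no  _    | yes _    = ≈-trans (+-congʳ (zeroˡ _)) (+-identityˡ _)
      ... | no  _    | no  _    = ≈-trans (+-congʳ (zeroˡ _)) (+-identityˡ _)

  sumList-allSubsets : ∀ k (f : Subset (suc k) → Carrier) →
                       sumList (allSubsets (suc k)) f ≈
                       sumList (allSubsets k) (λ A → f (true ∷ A)) + sumList (allSubsets k) (λ A → f (false ∷ A))
  sumList-allSubsets k f = ≈-trans (sumList-++ (List.map (true ∷_) (allSubsets k)) _ f)
                                   (+-cong (sumList-map (true ∷_) (allSubsets k) f) (sumList-map (false ∷_) (allSubsets k) f))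

  sumList-allSubsets-insert : ∀ k (e : Fin k) (h : Subset k → Carrier) →
                              sumList (allSubsets k) (λ A → [ lookup A e ] * h A) ≈
                              sumList (allSubsets k) (λ A → [ not (lookup A e) ] * h (A [ e ]≔ true))
  sumList-allSubsets-insert (suc k) F.zero h = begin
    sumList (allSubsets (suc k)) (λ A → [ lookup A F.zero ] * h A)
      ≈⟨ sumList-allSubsets k _ ⟩
    sumList subsets (λ A → 1# * h (true ∷ A)) + sumList subsets (λ A → 0# * h (false ∷ A))
      ≈⟨ +-comm _ _ ⟩
    sumList subsets (λ A → 0# * h (false ∷ A)) + sumList subsets (λ A → 1# * h (true ∷ A))
      ≈⟨ +-congʳ (sumList-cong subsets (λ A → ≈-trans (zeroˡ _) (≈-sym (zeroˡ _)))) ⟩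
    sumList subsets (λ A → 0# * h (true ∷ A)) + sumList subsets (λ A → 1# * h (true ∷ A))
      ≈⟨ sumList-allSubsets k _ ⟨
    sumList (allSubsets (suc k)) (λ A → [ not (lookup A F.zero) ] * h (A [ F.zero ]≔ true)) ∎
    where subsets = allSubsets k
  sumList-allSubsets-insert (suc k) (F.suc e) h = begin
    sumList (allSubsets (suc k)) (λ A → [ lookup A (F.suc e) ] * h A)
      ≈⟨ sumList-allSubsets k _ ⟩
    sumList subsets (λ A → [ lookup A e ] * h (true ∷ A)) + sumList subsets (λ A → [ lookup A e ] * h (false ∷ A))
      ≈⟨ +-cong (sumList-allSubsets-insert k e (λ A → h (true ∷ A))) (sumList-allSubsets-insert k e (λ A → h (false ∷ A))) ⟩
    sumList subsets (λ A → [ not (lookup A e) ] * h (true ∷ (A [ e ]≔ true)))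
      + sumList subsets (λ A → [ not (lookup A e) ] * h (false ∷ (A [ e ]≔ true)))
      ≈⟨ sumList-allSubsets k _ ⟨
    sumList (allSubsets (suc k)) (λ A → [ not (lookup A (F.suc e)) ] * h (A [ F.suc e ]≔ true)) ∎
    where subsets = allSubsets k

  prodFin-cong : ∀ k {f g : Fin k → Carrier} → (∀ i → f i ≈ g i) → prodFin k f ≈ prodFin k g
  prodFin-cong zero    h = ≈-refl
  prodFin-cong (suc k) h = *-cong (h F.zero) (prodFin-cong k (λ i → h (F.suc i)))

  prodFin-extract : ∀ k (g : Fin k → Carrier) (j : Fin k) →
                    prodFin k g ≈ g j * prodFin k (λ i → if ⌊ i Finₚ.≟ j ⌋ then 1# else g i)
  prodFin-extract (suc k) g F.zero = *-congˡ (≈-sym (*-identityˡ _))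
  prodFin-extract (suc k) g (F.suc j) = begin
    g F.zero * prodFin k (λ i → g (F.suc i))
      ≈⟨ *-congˡ (prodFin-extract k (λ i → g (F.suc i)) j) ⟩
    g F.zero * (g (F.suc j) * prodFin k (λ i → if ⌊ i Finₚ.≟ j ⌋ then 1# else g (F.suc i)))
      ≈⟨ x∙yz≈y∙xz _ _ _ ⟩
    g (F.suc j) * (g F.zero * prodFin k (λ i → if ⌊ i Finₚ.≟ j ⌋ then 1# else g (F.suc i)))
      ≈⟨ *-congˡ (*-congˡ (prodFin-cong k (λ i → reflexive (cong (if_then 1# else _) (sym (⌊≟⌋-suc i j)))))) ⟩
    g (F.suc j) * (g F.zero * prodFin k (λ i → if ⌊ F.suc i Finₚ.≟ F.suc j ⌋ then 1# else g (F.suc i))) ∎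
    where open CommutativeSemigroupProperties *-commutativeSemigroup using (x∙yz≈y∙xz)

module Connectivity {n m : ℕ} {G : Graph n m} (conn? : ∀ A u v → Dec (Walk G A u v)) where

  end₁ end₂ : Fin m → Fin n
  end₁ e = proj₁ (G e)
  end₂ e = proj₂ (G e)

  conn : Subset m → Fin n → Fin n → Bool
  conn A x y = ⌊ conn? A x y ⌋

  walk⇒conn : ∀ {A x y} → Walk G A x y → conn A x y ≡ true
  walk⇒conn {A} {x} {y} = ⌊⌋-yes (conn? A x y)

  ¬walk⇒¬conn : ∀ {A x y} → ¬ Walk G A x y → conn A x y ≡ false
  ¬walk⇒¬conn {A} {x} {y} = ⌊⌋-no (conn? A x y)

  conn⇒walk : ∀ {A x y} → conn A x y ≡ true → Walk G A x y
  conn⇒walk {A} {x} {y} = ⌊⌋≡true⇒ (conn? A x y)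

  conn-refl : ∀ A x → conn A x x ≡ true
  conn-refl A x = walk⇒conn []

  conn-sym : ∀ A x y → conn A x y ≡ conn A y x
  conn-sym A x y = ≡true-ext (λ h → walk⇒conn (reverseʷ (conn⇒walk h)))
                             (λ h → walk⇒conn (reverseʷ (conn⇒walk h)))

  conn-trans : ∀ {A x y z} → conn A x y ≡ true → conn A y z ≡ true → conn A x z ≡ true
  conn-trans h₁ h₂ = walk⇒conn (conn⇒walk h₁ ++ʷ conn⇒walk h₂)

  conn-respˡ : ∀ {A x y} → conn A x y ≡ true → ∀ z → conn A x z ≡ conn A y z
  conn-respˡ {A} {x} {y} xy z =
    ≡true-ext (conn-trans (trans (conn-sym A y x) xy)) (conn-trans xy)

  conn-mono : ∀ {A B} → (∀ {f} → f ∈ A → f ∈ B) → ∀ {x y} → conn A x y ≡ true → conn B x y ≡ true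
  conn-mono A⊆B h = walk⇒conn (weaken A⊆B (conn⇒walk h))

  conn-edge : ∀ {A} e → e ∈ A → conn A (end₁ e) (end₂ e) ≡ true
  conn-edge e e∈A = walk⇒conn (edgeWalk e e∈A)

  conn-edge-ends : ∀ {A f} → f ∈ A → ∀ x → conn A x (end₁ f) ≡ conn A x (end₂ f)
  conn-edge-ends {A} {f} f∈A x =
    trans (conn-sym A x _) (trans (conn-respˡ (conn-edge f f∈A) x) (conn-sym A _ x))

  record Extends (A B : Subset m) (e : Fin m) : Set where
    field
      B⊆A+e : ∀ {f} → f ∈ B → f ≡ e ⊎ f ∈ A
      A⊆B   : ∀ {f} → f ∈ A → f ∈ B
      e∈B   : e ∈ B

  Extends-insert : ∀ {A e} → ¬ (e ∈ A) → Extends A (A [ e ]≔ true) e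
  Extends-insert {A} {e} e∉A = record
    { B⊆A+e = λ f∈B → Data.Sum.map proj₁ proj₂ (∈-update⁻ f∈B)
    ; A⊆B   = A⊆B
    ; e∈B   = ∈-update-self A e
    }
    where
    A⊆B : ∀ {f} → f ∈ A → f ∈ (A [ e ]≔ true)
    A⊆B {f} f∈A with f Finₚ.≟ e
    ... | yes refl = ⊥-elim (e∉A f∈A)
    ... | no  f≢e  = ∈-update⁺ f≢e f∈A

  Extends-remove : ∀ {A e} → e ∈ A → Extends (A [ e ]≔ false) A e
  Extends-remove {A} {e} e∈A = record
    { B⊆A+e = B⊆A+e
    ; A⊆B   = A⊆B
    ; e∈B   = e∈A
    }
    where
    B⊆A+e : ∀ {f} → f ∈ A → f ≡ e ⊎ f ∈ (A [ e ]≔ false)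
    B⊆A+e {f} f∈A with f Finₚ.≟ e
    ... | yes f≡e = inj₁ f≡e
    ... | no  f≢e = inj₂ (∈-update⁺ f≢e f∈A)
    A⊆B : ∀ {f} → f ∈ (A [ e ]≔ false) → f ∈ A
    A⊆B f∈A⁻ with ∈-update⁻ f∈A⁻
    ... | inj₂ (_ , f∈A) = f∈A

  connVia : Subset m → Fin m → Fin n → Fin n → Bool
  connVia A e x y = conn A x y ∨ (conn A x (end₁ e) ∧ conn A (end₂ e) y) ∨ (conn A x (end₂ e) ∧ conn A (end₁ e) y)

  conn-extend : ∀ {A B e} → Extends A B e → ∀ x y → conn B x y ≡ connVia A e x y
  conn-extend {A} {B} {e} ext x y = ≡true-ext to from
    where
    open Extends ext
    to : conn B x y ≡ true → connVia A e x y ≡ true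
    to h with splitAt e B⊆A+e (conn⇒walk h)
    ... | inj₁ w                 rewrite walk⇒conn w = refl
    ... | inj₂ (inj₁ (w₁ , w₂)) rewrite walk⇒conn w₁ | walk⇒conn w₂ = Boolₚ.∨-zeroʳ _
    ... | inj₂ (inj₂ (w₁ , w₂)) rewrite walk⇒conn w₁ | walk⇒conn w₂ =
      trans (cong (conn A x y ∨_) (Boolₚ.∨-zeroʳ _)) (Boolₚ.∨-zeroʳ _)
    from : connVia A e x y ≡ true → conn B x y ≡ true
    from h with ∨≡true h
    ... | inj₁ h₁ = conn-mono A⊆B h₁
    ... | inj₂ h₂ with ∨≡true h₂
    ...   | inj₁ h₃ = let p , q = ∧≡true h₃ in
                      walk⇒conn (weaken A⊆B (conn⇒walk p) ++ʷ edgeWalk e e∈B ++ʷ weaken A⊆B (conn⇒walk q))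
    ...   | inj₂ h₃ = let p , q = ∧≡true h₃ in
                      walk⇒conn (weaken A⊆B (conn⇒walk p) ++ʷ reverseʷ (edgeWalk e e∈B) ++ʷ weaken A⊆B (conn⇒walk q))

  vertexCount : Subset m → Fin n → ℕ
  vertexCount A x = countFin n (conn A x)

  edgeCount : Subset m → Fin n → ℕ
  edgeCount A x = countFin m (λ f → lookup A f ∧ conn A x (end₁ f))

module TreeConnectivity {n m : ℕ} {G : Graph n m} (tree : IsTree G)
                        (conn? : ∀ A u v → Dec (Walk G A u v)) where
  open Connectivity conn? public

  E : Subset m
  E = fullSet G

  ∈E : ∀ {f} → f ∈ E
  ∈E {f} = lookup⇒∈ (Vecₚ.lookup-replicate f true)

  connected : ∀ u v → Walk G E u v
  connected = proj₁ (proj₂ (proj₂ tree))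

  path-unique : ∀ {A B u v} (p : Walk G A u v) (q : Walk G B u v) → IsPath G p → IsPath G q →
                walkEdges G p ≡ walkEdges G q
  path-unique p q p-path q-path = begin
    walkEdges G p             ≡⟨ walkEdges-weaken (λ _ → ∈E) p ⟨
    walkEdges G (weaken _ p)  ≡⟨ proj₂ (proj₂ (proj₂ tree)) _ _ (weaken _ p) (weaken _ q)
                                   (IsPath-weaken _ p p-path) (IsPath-weaken _ q q-path) ⟩
    walkEdges G (weaken _ q)  ≡⟨ walkEdges-weaken (λ _ → ∈E) q ⟩
    walkEdges G q             ∎
    where open ≡-Reasoning

  Acyclic-tree : ∀ A → Acyclic G A
  Acyclic-tree A u v = path-unique

  -- The edge e is itself a path between its ends, so every path between them is e.
  ¬conn-ends : ∀ {A} e → ¬ (e ∈ A) → conn A (end₁ e) (end₂ e) ≡ false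
  ¬conn-ends {A} e e∉A = ¬walk⇒¬conn λ w →
    let q , q-path = toPath w
        single = edgeWalk e ∈E
        loopless = proj₁ (proj₂ tree) e
    in e∉A (walkEdges⊆ q (subst (e ∈ₗ_) (sym (path-unique q single q-path ((loopless ∷ []) ∷ ([] ∷ []))))
                                   (here refl)))

  E∖_ : Fin m → Subset m
  E∖ e = E [ e ]≔ false

  ∈E∖ : ∀ {e f} → f ≢ e → f ∈ E∖ e
  ∈E∖ f≢e = ∈-update⁺ f≢e ∈E

  ∉E∖ : ∀ e → ¬ (e ∈ E∖ e)
  ∉E∖ e = ∉-update-false E e

  ¬conn-E∖ : ∀ e → conn (E∖ e) (end₁ e) (end₂ e) ≡ false
  ¬conn-E∖ e = ¬conn-ends e (∉E∖ e)

  conn-E∖-sides : ∀ e y → conn (E∖ e) (end₁ e) y ≡ not (conn (E∖ e) (end₂ e) y)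
  conn-E∖-sides e y with conn-extend (Extends-remove {E} {e} ∈E) (end₁ e) y
  ... | via with conn (E∖ e) (end₁ e) y in ay | conn (E∖ e) (end₂ e) y in by
  ...   | true  | false = refl
  ...   | false | true  = refl
  ...   | true  | true  = ⊥-elim (true≢false (conn-trans ay (trans (conn-sym _ y _) by)) (¬conn-E∖ e))
  ...   | false | false = ⊥-elim (true≢false (walk⇒conn (connected (end₁ e) y)) (trans via neither))
    where
    neither : false ∨ (conn (E∖ e) (end₁ e) (end₁ e) ∧ false) ∨ (conn (E∖ e) (end₁ e) (end₂ e) ∧ false) ≡ false
    neither rewrite Boolₚ.∧-zeroʳ (conn (E∖ e) (end₁ e) (end₁ e)) | Boolₚ.∧-zeroʳ (conn (E∖ e) (end₁ e) (end₂ e)) = refl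

  ⊆E∖ : ∀ {A e} → ¬ (e ∈ A) → ∀ {f} → f ∈ A → f ∈ E∖ e
  ⊆E∖ e∉A {f} f∈A = ∈E∖ (λ { refl → e∉A f∈A })

  -- Both walks reduce to the unique path from x to y, whose edges lie in A and in B.
  conn-meet : ∀ {A B C x y} → (∀ {f} → f ∈ A → f ∈ B → f ∈ C) →
              conn A x y ≡ true → conn B x y ≡ true → conn C x y ≡ true
  conn-meet A∩B⊆C xy-A xy-B = walk⇒conn (restrict p (λ f∈p →
      A∩B⊆C (walkEdges⊆ p f∈p) (walkEdges⊆ q (subst (_ ∈ₗ_) (path-unique p q p-path q-path) f∈p))))
    where
    p = proj₁ (toPath (conn⇒walk xy-A))
    p-path = proj₂ (toPath (conn⇒walk xy-A))
    q = proj₁ (toPath (conn⇒walk xy-B))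
    q-path = proj₂ (toPath (conn⇒walk xy-B))

  conn-E∖-by-side : ∀ e y z → conn (E∖ e) y z ≡ not (conn (E∖ e) (end₁ e) y xor conn (E∖ e) (end₁ e) z)
  conn-E∖-by-side e y z with conn (E∖ e) (end₁ e) y in ay | conn (E∖ e) (end₁ e) z in az
  ... | true  | true  = conn-trans (trans (conn-sym _ y _) ay) az
  ... | true  | false = ¬walk⇒¬conn (λ w → true≢false (conn-trans ay (walk⇒conn w)) az)
  ... | false | true  = ¬walk⇒¬conn (λ w → true≢false (conn-trans az (walk⇒conn (reverseʷ w))) ay)
  ... | false | false = conn-trans (trans (conn-sym _ y _) (other-side ay)) (other-side az)
    where
    other-side : ∀ {v} → conn (E∖ e) (end₁ e) v ≡ false → conn (E∖ e) (end₂ e) v ≡ true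
    other-side {v} av = Boolₚ.not-injective (trans (sym (conn-E∖-sides e v)) av)

  size : Subset m → ℕ
  size A = countFin m (lookup A)

  module Removal {A : Subset m} {e : Fin m} (e∈A : e ∈ A) where
    A⁻ : Subset m
    A⁻ = A [ e ]≔ false

    count-remove : ∀ t → countFin m (λ f → lookup A f ∧ t f) ≡ (if t e then 1 else 0) ℕ.+ countFin m (λ f → lookup A⁻ f ∧ t f)
    count-remove t = trans (countFin-split m _ _ _ split disjoint t) (cong (ℕ._+ countFin m (λ f → lookup A⁻ f ∧ t f)) (countFin-≟-∧ m e t))
      where
      split : ∀ f → lookup A f ≡ ⌊ f Finₚ.≟ e ⌋ ∨ lookup A⁻ f
      split f rewrite lookup-update A e f false with f Finₚ.≟ e
      ... | yes refl = ∈⇒lookup e∈A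
      ... | no  _    = refl
      disjoint : ∀ f → ⌊ f Finₚ.≟ e ⌋ ∧ lookup A⁻ f ≡ false
      disjoint f rewrite lookup-update A e f false with f Finₚ.≟ e
      ... | yes refl = refl
      ... | no  _    = refl

    count-remove-true : ∀ t → t e ≡ true →
                        countFin m (λ f → lookup A f ∧ t f) ≡ suc (countFin m (λ f → lookup A⁻ f ∧ t f))
    count-remove-true t te =
      trans (count-remove t) (cong (λ c → (if c then 1 else 0) ℕ.+ countFin m (λ f → lookup A⁻ f ∧ t f)) te)

    count-remove-false : ∀ t → t e ≡ false →
                         countFin m (λ f → lookup A f ∧ t f) ≡ countFin m (λ f → lookup A⁻ f ∧ t f)
    count-remove-false t te =
      trans (count-remove t) (cong (λ c → (if c then 1 else 0) ℕ.+ countFin m (λ f → lookup A⁻ f ∧ t f)) te)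

    size-remove : size A ≡ suc (size A⁻)
    size-remove = begin
      countFin m (lookup A)                  ≡⟨ countFin-cong m (λ f → Boolₚ.∧-identityʳ _) ⟨
      countFin m (λ f → lookup A f ∧ true)   ≡⟨ count-remove-true (λ _ → true) refl ⟩
      suc (countFin m (λ f → lookup A⁻ f ∧ true)) ≡⟨ cong suc (countFin-cong m (λ f → Boolₚ.∧-identityʳ _)) ⟩
      suc (countFin m (lookup A⁻))           ∎
      where open ≡-Reasoning

    private
      a b : Fin n
      a = end₁ e
      b = end₂ e

    ¬conn⁻-ends : conn A⁻ a b ≡ false
    ¬conn⁻-ends = ¬conn-ends e (∉-update-false A e)

    conn-remove : ∀ x y → conn A x y ≡ connVia A⁻ e x y
    conn-remove = conn-extend (Extends-remove e∈A)

    conn-from-end : ∀ y → conn A a y ≡ conn A⁻ a y ∨ conn A⁻ b y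
    conn-from-end y rewrite conn-remove a y | conn-refl A⁻ a | ¬conn⁻-ends =
      cong (conn A⁻ a y ∨_) (Boolₚ.∨-identityʳ _)

    sides-disjoint : ∀ y → conn A⁻ a y ∧ conn A⁻ b y ≡ false
    sides-disjoint y with conn A⁻ a y in ay | conn A⁻ b y in by
    ... | true  | true  = ⊥-elim (true≢false (conn-trans ay (trans (conn-sym _ y b) by)) ¬conn⁻-ends)
    ... | true  | false = refl
    ... | false | _     = refl

    -- Removing e splits the component of a into the components of its two ends.
    euler-at-end : (∀ x → vertexCount A⁻ x ≡ suc (edgeCount A⁻ x)) → vertexCount A a ≡ suc (edgeCount A a)
    euler-at-end ih = begin
      vertexCount A a                                 ≡⟨ countFin-cong n conn-from-end ⟩
      countFin n (λ y → conn A⁻ a y ∨ conn A⁻ b y)     ≡⟨ countFin-∨ n _ _ sides-disjoint ⟩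
      vertexCount A⁻ a ℕ.+ vertexCount A⁻ b          ≡⟨ cong₂ ℕ._+_ (ih a) (ih b) ⟩
      suc (edgeCount A⁻ a) ℕ.+ suc (edgeCount A⁻ b)  ≡⟨ cong suc (ℕₚ.+-suc _ _) ⟩
      suc (suc (edgeCount A⁻ a ℕ.+ edgeCount A⁻ b))  ≡⟨ cong (suc ∘ suc) (countFin-∨ m _ _ edges-disjoint) ⟨
      suc (suc (countFin m (λ f → (lookup A⁻ f ∧ conn A⁻ a (end₁ f)) ∨ (lookup A⁻ f ∧ conn A⁻ b (end₁ f)))))
        ≡⟨ cong (suc ∘ suc) (countFin-cong m (λ f → Boolₚ.∧-distribˡ-∨ (lookup A⁻ f) _ _)) ⟨
      suc (suc (countFin m (λ f → lookup A⁻ f ∧ (conn A⁻ a (end₁ f) ∨ conn A⁻ b (end₁ f)))))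
        ≡⟨ cong suc e-joins ⟨
      suc (countFin m (λ f → lookup A f ∧ (conn A⁻ a (end₁ f) ∨ conn A⁻ b (end₁ f))))
        ≡⟨ cong suc (countFin-cong m (λ f → cong (lookup A f ∧_) (conn-from-end (end₁ f)))) ⟨
      suc (edgeCount A a)                             ∎
      where
      open ≡-Reasoning
      e-joins : countFin m (λ f → lookup A f ∧ (conn A⁻ a (end₁ f) ∨ conn A⁻ b (end₁ f)))
              ≡ suc (countFin m (λ f → lookup A⁻ f ∧ (conn A⁻ a (end₁ f) ∨ conn A⁻ b (end₁ f))))
      e-joins = count-remove-true _ (cong (_∨ conn A⁻ b a) (conn-refl A⁻ a))
      edges-disjoint : ∀ f → (lookup A⁻ f ∧ conn A⁻ a (end₁ f)) ∧ (lookup A⁻ f ∧ conn A⁻ b (end₁ f)) ≡ false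
      edges-disjoint f with lookup A⁻ f
      ... | false = refl
      ... | true  = sides-disjoint (end₁ f)

    euler-away : ∀ x → conn A a x ≡ false → vertexCount A⁻ x ≡ suc (edgeCount A⁻ x) →
                 vertexCount A x ≡ suc (edgeCount A x)
    euler-away x ¬ax ih = begin
      vertexCount A x                                 ≡⟨ countFin-cong n same ⟩
      vertexCount A⁻ x                                ≡⟨ ih ⟩
      suc (edgeCount A⁻ x)                            ≡⟨ cong suc (countFin-cong m (λ f → cong (lookup A⁻ f ∧_) (same (end₁ f)))) ⟨
      suc (countFin m (λ f → lookup A⁻ f ∧ conn A x (end₁ f)))
        ≡⟨ cong suc (count-remove-false (λ f → conn A x (end₁ f)) ¬xa) ⟨
      suc (edgeCount A x)                             ∎
      where
      open ≡-Reasoning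
      ¬xa : conn A x a ≡ false
      ¬xa = trans (conn-sym A x a) ¬ax
      ¬xa⁻ : conn A⁻ x a ≡ false
      ¬xa⁻ with conn A⁻ x a in xa
      ... | false = refl
      ... | true  = ⊥-elim (true≢false (conn-mono (Extends.A⊆B (Extends-remove e∈A)) xa) ¬xa)
      ¬xb⁻ : conn A⁻ x b ≡ false
      ¬xb⁻ with conn A⁻ x b in xb
      ... | false = refl
      ... | true  = ⊥-elim (true≢false
                      (conn-trans (conn-mono (Extends.A⊆B (Extends-remove e∈A)) xb)
                                  (trans (conn-sym A b a) (conn-edge e e∈A))) ¬xa)
      same : ∀ y → conn A x y ≡ conn A⁻ x y
      same y rewrite conn-remove x y | ¬xa⁻ | ¬xb⁻ = Boolₚ.∨-identityʳ _

  vertexCount≡1+edgeCount : ∀ A x → vertexCount A x ≡ suc (edgeCount A x)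
  vertexCount≡1+edgeCount A = go (size A) A refl
    where
    go : ∀ k A → size A ≡ k → ∀ x → vertexCount A x ≡ suc (edgeCount A x)
    go zero A empty x = begin
      countFin n (conn A x)                   ≡⟨ countFin-cong n isolated ⟩
      countFin n (λ y → ⌊ y Finₚ.≟ x ⌋)      ≡⟨ countFin-≟ n x ⟩
      1                                       ≡⟨ cong suc (countFin-false m) ⟨
      suc (countFin m (λ _ → false))          ≡⟨ cong suc (countFin-cong m (λ f → cong (_∧ conn A x (end₁ f)) (no-edges f))) ⟨
      suc (edgeCount A x)                     ∎
      where
      open ≡-Reasoning
      no-edges : ∀ f → lookup A f ≡ false
      no-edges = countFin≡0⇒ m (lookup A) empty
      stays : ∀ {y z} → Walk G A y z → y ≡ z
      stays []               = refl
      stays (step f i _ _)   = ⊥-elim (true≢false (∈⇒lookup i) (no-edges f))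
      isolated : ∀ y → conn A x y ≡ ⌊ y Finₚ.≟ x ⌋
      isolated y = ≡true-ext (λ h → ⌊⌋-yes (y Finₚ.≟ x) (sym (stays (conn⇒walk h))))
                             (λ h → subst (λ z → conn A x z ≡ true) (sym (⌊⌋≡true⇒ (y Finₚ.≟ x) h)) (conn-refl A x))
    go (suc k) A size≡ x with countFin≡suc⇒ m (lookup A) size≡
    ... | e , Ae = step-case
      where
      open Removal {A} {e} (lookup⇒∈ Ae)
      ih : ∀ y → vertexCount A⁻ y ≡ suc (edgeCount A⁻ y)
      ih = go k A⁻ (ℕₚ.suc-injective (trans (sym size-remove) size≡))
      step-case : vertexCount A x ≡ suc (edgeCount A x)
      step-case with conn A (end₁ e) x in ax
      ... | false = euler-away x ax (ih x)
      ... | true  = begin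
        vertexCount A x              ≡⟨ countFin-cong n (conn-respˡ (trans (conn-sym A x _) ax)) ⟩
        vertexCount A (end₁ e)       ≡⟨ euler-at-end ih ⟩
        suc (edgeCount A (end₁ e))   ≡⟨ cong suc (countFin-cong m (λ f → cong (lookup A f ∧_) (conn-respˡ ax (end₁ f)))) ⟩
        suc (edgeCount A x)          ∎
        where open ≡-Reasoning

module ComponentSums {c ℓ} (R : CommutativeRing c ℓ) {n m : ℕ} {G : Graph n m} (tree : IsTree G)
                     (conn? : ∀ A u v → Dec (Walk G A u v)) where
  open CommutativeRing R renaming (refl to ≈-refl; sym to ≈-sym; trans to ≈-trans)
  open RingSums R
  open RingSumProperties R
  open RingProperties ring using (x[y-z]≈xy-xz)
  open TreeConnectivity tree conn? public
  open import Relation.Binary.Reasoning.Setoid setoid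

  deg : Fin n → Carrier
  deg x = sumFin m (λ f → [ ⌊ end₁ f Finₚ.≟ x ⌋ ] + [ ⌊ end₂ f Finₚ.≟ x ⌋ ])

  τ : Fin n → Carrier
  τ x = two - deg x

  outdeg : Subset m → Fin n → ℕ
  outdeg A x = countFin m (λ f → conn A x (end₁ f) xor conn A x (end₂ f))

  -- An edge inside the component counts twice, an edge leaving it once.
  degree-sum : ∀ A x₀ → sumFin n (λ x → [ conn A x₀ x ] * deg x) ≈ two * fromℕ (edgeCount A x₀) + fromℕ (outdeg A x₀)
  degree-sum A x₀ = begin
    sumFin n (λ x → [ C x ] * deg x)
      ≈⟨ sumFin-cong n (λ x → *-distribˡ-sumFin m _ _) ⟩
    sumFin n (λ x → sumFin m (λ f → [ C x ] * ([ ⌊ end₁ f Finₚ.≟ x ⌋ ] + [ ⌊ end₂ f Finₚ.≟ x ⌋ ])))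
      ≈⟨ sumFin-swap n m _ ⟩
    sumFin m (λ f → sumFin n (λ x → [ C x ] * ([ ⌊ end₁ f Finₚ.≟ x ⌋ ] + [ ⌊ end₂ f Finₚ.≟ x ⌋ ])))
      ≈⟨ sumFin-cong m per-edge ⟩
    sumFin m (λ f → two * [ lookup A f ∧ C (end₁ f) ] + [ C (end₁ f) xor C (end₂ f) ])
      ≈⟨ sumFin-+ m _ _ ⟩
    sumFin m (λ f → two * [ lookup A f ∧ C (end₁ f) ]) + sumFin m (λ f → [ C (end₁ f) xor C (end₂ f) ])
      ≈⟨ +-congʳ (*-distribˡ-sumFin m two _) ⟨
    two * sumFin m (λ f → [ lookup A f ∧ C (end₁ f) ]) + sumFin m (λ f → [ C (end₁ f) xor C (end₂ f) ])
      ≈⟨ +-cong (*-congˡ (fromℕ-countFin m _)) (fromℕ-countFin m _) ⟨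
    two * fromℕ (edgeCount A x₀) + fromℕ (outdeg A x₀) ∎
    where
    C : Fin n → Bool
    C = conn A x₀
    both-ends : ∀ f → C (end₁ f) ∧ C (end₂ f) ≡ lookup A f ∧ C (end₁ f)
    both-ends f with lookup A f in f∈A
    ... | true  = trans (cong (C (end₁ f) ∧_) (sym same-side)) (Boolₚ.∧-idem _)
      where same-side : C (end₁ f) ≡ C (end₂ f)
            same-side = conn-edge-ends (lookup⇒∈ f∈A) x₀
    ... | false with C (end₁ f) in a | C (end₂ f) in b
    ...   | true  | true  = ⊥-elim (true≢false (conn-trans (trans (conn-sym A _ x₀) a) b)
                                             (¬conn-ends f (λ f∈A′ → true≢false (∈⇒lookup f∈A′) f∈A)))
    ...   | true  | false = refl
    ...   | false | _     = refl
    per-edge : ∀ f → sumFin n (λ x → [ C x ] * ([ ⌊ end₁ f Finₚ.≟ x ⌋ ] + [ ⌊ end₂ f Finₚ.≟ x ⌋ ])) ≈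
                     two * [ lookup A f ∧ C (end₁ f) ] + [ C (end₁ f) xor C (end₂ f) ]
    per-edge f = begin
      sumFin n (λ x → [ C x ] * ([ ⌊ end₁ f Finₚ.≟ x ⌋ ] + [ ⌊ end₂ f Finₚ.≟ x ⌋ ]))
        ≈⟨ ≈-trans (sumFin-cong n (λ x → distribˡ _ _ _)) (sumFin-+ n _ _) ⟩
      sumFin n (λ x → [ C x ] * [ ⌊ end₁ f Finₚ.≟ x ⌋ ]) + sumFin n (λ x → [ C x ] * [ ⌊ end₂ f Finₚ.≟ x ⌋ ])
        ≈⟨ +-cong (sumFin-[]*[≟] n C (end₁ f)) (sumFin-[]*[≟] n C (end₂ f)) ⟩
      [ C (end₁ f) ] + [ C (end₂ f) ]
        ≈⟨ []+[]≈2[∧]+[xor] (C (end₁ f)) (C (end₂ f)) ⟩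
      two * [ C (end₁ f) ∧ C (end₂ f) ] + [ C (end₁ f) xor C (end₂ f) ]
        ≈⟨ +-congʳ (*-congˡ (reflexive (cong [_] (both-ends f)))) ⟩
      two * [ lookup A f ∧ C (end₁ f) ] + [ C (end₁ f) xor C (end₂ f) ] ∎

  -- Euler's formula turns the degree sum into 2 − outdeg.
  τ-sum : ∀ A x₀ → sumFin n (λ x → [ conn A x₀ x ] * τ x) ≈ two - fromℕ (outdeg A x₀)
  τ-sum A x₀ = begin
    sumFin n (λ x → [ C x ] * (two - deg x))
      ≈⟨ ≈-trans (sumFin-cong n (λ x → x[y-z]≈xy-xz _ _ _)) (sumFin-minus n _ _) ⟩
    sumFin n (λ x → [ C x ] * two) - sumFin n (λ x → [ C x ] * deg x)
      ≈⟨ +-cong (≈-sym (*-distribʳ-sumFin n two _)) (-‿cong (degree-sum A x₀)) ⟩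
    sumFin n (λ x → [ C x ]) * two - (two * fromℕ ε + fromℕ (outdeg A x₀))
      ≈⟨ +-congʳ (*-congʳ (fromℕ-countFin n C)) ⟨
    fromℕ (vertexCount A x₀) * two - (two * fromℕ ε + fromℕ (outdeg A x₀))
      ≈⟨ +-congʳ (*-congʳ (reflexive (cong fromℕ (vertexCount≡1+edgeCount A x₀)))) ⟩
    (1# + fromℕ ε) * two - (two * fromℕ ε + fromℕ (outdeg A x₀))
      ≈⟨ +-congʳ (≈-trans (distribʳ two _ _) (+-cong (*-identityˡ two) (*-comm _ two))) ⟩
    (two + two * fromℕ ε) - (two * fromℕ ε + fromℕ (outdeg A x₀))
      ≈⟨ [a+b]-[b+c]≈a-c _ _ _ ⟩
    two - fromℕ (outdeg A x₀) ∎
    where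
    C : Fin n → Bool
    C = conn A x₀
    ε : ℕ
    ε = edgeCount A x₀

module Separation {c ℓ} (R : CommutativeRing c ℓ) {n m : ℕ} {G : Graph n m} (tree : IsTree G)
                  (conn? : ∀ A u v → Dec (Walk G A u v)) (u : Fin n) where
  open CommutativeRing R renaming (refl to ≈-refl; sym to ≈-sym; trans to ≈-trans)
  open RingSums R
  open RingSumProperties R
  open ComponentSums R tree conn? public
  open DecMembership (Finₚ._≟_ {m}) using (_∈?_)
  open import Relation.Binary.Reasoning.Setoid setoid

  separates : Fin m → Fin n → Bool
  separates e x = not (conn (E∖ e) u x)

  separates-resp : ∀ {e y z} → conn (E∖ e) y z ≡ true → separates e y ≡ separates e z
  separates-resp {e} {y} {z} yz = cong not (trans (conn-sym _ u y) (trans (conn-respˡ yz u) (conn-sym _ z u)))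

  separates-flip : ∀ {e x y} → conn (E∖ e) x y ≡ false → separates e y ≡ not (separates e x)
  separates-flip {e} {x} {y} ¬xy rewrite conn-E∖-by-side e u x | conn-E∖-by-side e u y =
    flip (conn (E∖ e) (end₁ e) u) (conn (E∖ e) (end₁ e) x) (conn (E∖ e) (end₁ e) y)
         (trans (sym (conn-E∖-by-side e x y)) ¬xy)
    where
    flip : ∀ a b c → not (b xor c) ≡ false → not (not (a xor c)) ≡ not (not (not (a xor b)))
    flip true  true  false _ = refl
    flip true  false true  _ = refl
    flip false true  false _ = refl
    flip false false true  _ = refl

  separating-component : ∀ e → Σ (Fin n) (λ v → ∀ x → separates e x ≡ conn (E∖ e) v x)
  separating-component e with conn (E∖ e) u (end₁ e) in ua
  ... | true  = end₂ e , λ x → trans (cong not (trans (conn-respˡ ua x) (conn-E∖-sides e x))) (Boolₚ.not-involutive _)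
  ... | false = end₁ e , λ x → trans (cong not (conn-respˡ ub x)) (sym (conn-E∖-sides e x))
    where
    ub : conn (E∖ e) u (end₂ e) ≡ true
    ub = trans (conn-sym _ u _) (Boolₚ.not-injective (trans (sym (conn-E∖-sides e u)) (trans (conn-sym _ _ u) ua)))

  outdeg-E∖ : ∀ e v → outdeg (E∖ e) v ≡ 1
  outdeg-E∖ e v = trans (countFin-cong m only-e) (countFin-≟ m e)
    where
    only-e : ∀ f → (conn (E∖ e) v (end₁ f) xor conn (E∖ e) v (end₂ f)) ≡ ⌊ f Finₚ.≟ e ⌋
    only-e f with f Finₚ.≟ e
    ... | no  f≢e  = trans (cong (_xor conn (E∖ e) v (end₂ f)) (conn-edge-ends (∈E∖ f≢e) v))
                           (Boolₚ.xor-same (conn (E∖ e) v (end₂ f)))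
    ... | yes refl rewrite conn-sym (E∖ e) v (end₁ e) | conn-E∖-sides e v | conn-sym (E∖ e) (end₂ e) v =
      Boolₚ.xor-inverseˡ (conn (E∖ e) v (end₂ e))

  τ-sum-separated : ∀ e → sumFin n (λ x → [ separates e x ] * τ x) ≈ 1#
  τ-sum-separated e = begin
    sumFin n (λ x → [ separates e x ] * τ x)    ≈⟨ sumFin-cong n (λ x → []-cong (sep≡ x) (τ x)) ⟩
    sumFin n (λ x → [ conn (E∖ e) v x ] * τ x)  ≈⟨ τ-sum (E∖ e) v ⟩
    two - fromℕ (outdeg (E∖ e) v)              ≡⟨ cong (λ k → two - fromℕ k) (outdeg-E∖ e v) ⟩
    two - fromℕ 1                              ≈⟨ two-1≈1 ⟩
    1#                                         ∎
    where
    v = proj₁ (separating-component e)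
    sep≡ = proj₂ (separating-component e)

  path-separates : ∀ {x} (p : Walk G E u x) → IsPath G p → ∀ e → ⌊ e ∈? walkEdges G p ⌋ ≡ separates e x
  path-separates {x} p p-path e with e ∈? walkEdges G p
  ... | no  e∉p = sym (cong not (walk⇒conn (restrict p (λ {f} f∈p → ∈E∖ (λ { refl → e∉p f∈p })))))
  ... | yes e∈p with conn? (E∖ e) u x
  ...   | no  _ = refl
  ...   | yes w = ⊥-elim (∉E∖ e (walkEdges⊆ q (subst (e ∈ₗ_) (path-unique p q p-path q-path) e∈p)))
    where
    q = proj₁ (toPath w)
    q-path = proj₂ (toPath w)

  distance-as-sum : (α : Fin m → Carrier) (D : Fin n → Fin n → Carrier) →
                    (∀ u v (p : Walk G E u v) → IsPath G p → D u v ≈ sumList (walkEdges G p) α) →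
                    ∀ x → D u x ≈ sumFin m (λ e → [ separates e x ] * α e)
  distance-as-sum α D D-paths x = begin
    D u x                                              ≈⟨ D-paths u x p p-path ⟩
    sumList (walkEdges G p) α                          ≈⟨ sumList-Unique (walkEdges G p) (path⇒walkEdges-unique p p-path) α ⟩
    sumFin m (λ e → [ ⌊ e ∈? walkEdges G p ⌋ ] * α e) ≈⟨ sumFin-cong m (λ e → []-cong (path-separates p p-path e) (α e)) ⟩
    sumFin m (λ e → [ separates e x ] * α e)           ∎
    where
    p = proj₁ (toPath (connected u x))
    p-path = proj₂ (toPath (connected u x))

-- The definitions below coincide definitionally with those of RingSums.Forests, which
-- are parameterised by a ring only for the weights.
module ForestClasses {n m : ℕ} {G : Graph n m} (tree : IsTree G)
                     (conn? : ∀ A u v → Dec (Walk G A u v))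
                     (acyc? : ∀ A → Dec (Acyclic G A)) (S : Subset n) where
  open TreeConnectivity tree conn?

  inS : Fin n → Bool
  inS s = s ∈ᵇ S

  sCount : Subset m → Fin n → ℕ
  sCount A x = countFin n (λ s → inS s ∧ conn A x s)

  free : Subset m → Fin n → Bool
  free A x = ⌊ sCount A x ℕ.≟ 0 ⌋

  isF₁ : Subset m → Bool
  isF₁ A = ⌊ acyc? A ⌋ ∧ allFin n (λ x → ⌊ sCount A x ℕ.≟ 1 ⌋)

  isF₂ : Subset m → Bool
  isF₂ A = ⌊ acyc? A ⌋
         ∧ allFin n (λ x → ⌊ sCount A x ℕ.≤? 1 ⌋)
         ∧ anyFin n (free A)
         ∧ allFin n (λ x → allFin n (λ y → not (free A x ∧ free A y) ∨ conn A x y))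

  boundary : Subset m → Fin m → Bool
  boundary A e = free A (end₁ e) xor free A (end₂ e)

  acyc≡true : ∀ A → ⌊ acyc? A ⌋ ≡ true
  acyc≡true A = ⌊⌋-yes (acyc? A) (Acyclic-tree A)

  sCount-resp : ∀ {A x y} → conn A x y ≡ true → sCount A x ≡ sCount A y
  sCount-resp xy = countFin-cong n (λ s → cong (inS s ∧_) (conn-respˡ xy s))

  free-resp : ∀ {A x y} → conn A x y ≡ true → free A x ≡ free A y
  free-resp xy = cong (λ k → ⌊ k ℕ.≟ 0 ⌋) (sCount-resp xy)

  free⇒¬conn : ∀ {A x s} → free A x ≡ true → inS s ≡ true → conn A x s ≡ false
  free⇒¬conn {A} {x} {s} fx s∈S =
    trans (cong (_∧ conn A x s) (sym s∈S)) (countFin≡0⇒ n _ (⌊⌋≡true⇒ (sCount A x ℕ.≟ 0) fx) s)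

  ¬free⇒conn : ∀ {A x} → free A x ≡ false → Σ (Fin n) (λ s → inS s ∧ conn A x s ≡ true)
  ¬free⇒conn {A} {x} ¬fx with sCount A x in count
  ... | suc _ = countFin≡suc⇒ n _ count

  conn⇒¬free : ∀ {A x} s → inS s ∧ conn A x s ≡ true → free A x ≡ false
  conn⇒¬free {A} {x} s h =
    ⌊⌋-no (sCount A x ℕ.≟ 0) (λ count → true≢false h (countFin≡0⇒ n _ count s))

  ¬free⇒sCount≡1 : ∀ {A x} → sCount A x ≤ 1 → free A x ≡ false → sCount A x ≡ 1
  ¬free⇒sCount≡1 {A} {x} ≤1 ¬fx with sCount A x
  ... | suc zero    = refl
  ... | suc (suc _) = case ≤1 of λ { (s≤s ()) }

  boundary-∈ : ∀ {A f} → f ∈ A → boundary A f ≡ false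
  boundary-∈ {A} {f} f∈A rewrite free-resp (conn-edge f f∈A) = Boolₚ.xor-same (free A (end₂ f))

  isF₁⇒ : ∀ {A} → isF₁ A ≡ true → ∀ x → sCount A x ≡ 1
  isF₁⇒ {A} h x = ⌊⌋≡true⇒ (sCount A x ℕ.≟ 1) (allFin-sound n _ (proj₂ (∧≡true {⌊ acyc? A ⌋} h)) x)

  isF₁⇐ : ∀ {A} → (∀ x → sCount A x ≡ 1) → isF₁ A ≡ true
  isF₁⇐ {A} h rewrite acyc≡true A = allFin-complete n _ (λ x → ⌊⌋-yes (sCount A x ℕ.≟ 1) (h x))

  record IsF₂ (A : Subset m) : Set where
    field
      sCount≤1       : ∀ x → sCount A x ≤ 1
      floating       : Fin n
      floating-free  : free A floating ≡ true
      free-connected : ∀ x y → free A x ≡ true → free A y ≡ true → conn A x y ≡ true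

  isF₂⇒ : ∀ {A} → isF₂ A ≡ true → IsF₂ A
  isF₂⇒ {A} h = record
    { sCount≤1       = λ x → ⌊⌋≡true⇒ (sCount A x ℕ.≤? 1) (allFin-sound n _ (proj₁ h₂) x)
    ; floating       = proj₁ some-free
    ; floating-free  = proj₂ some-free
    ; free-connected = connected-free
    }
    where
    h₁ = proj₂ (∧≡true {⌊ acyc? A ⌋} h)
    h₂ = ∧≡true {allFin n (λ x → ⌊ sCount A x ℕ.≤? 1 ⌋)} h₁
    h₃ = ∧≡true {anyFin n (free A)} (proj₂ h₂)
    some-free = anyFin-sound n _ (proj₁ h₃)
    connected-free : ∀ x y → free A x ≡ true → free A y ≡ true → conn A x y ≡ true
    connected-free x y fx fy with allFin-sound n _ (allFin-sound n _ (proj₂ h₃) x) y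
    ... | xy rewrite fx | fy = xy

  isF₂⇐ : ∀ {A} → IsF₂ A → isF₂ A ≡ true
  isF₂⇐ {A} F₂ rewrite acyc≡true A
    | allFin-complete n (λ x → ⌊ sCount A x ℕ.≤? 1 ⌋) (λ x → ⌊⌋-yes (sCount A x ℕ.≤? 1) (IsF₂.sCount≤1 F₂ x))
    | anyFin-complete n (free A) (IsF₂.floating F₂) (IsF₂.floating-free F₂)
    = allFin-complete n _ (λ x → allFin-complete n _ (λ y → free-pair x y))
    where
    free-pair : ∀ x y → not (free A x ∧ free A y) ∨ conn A x y ≡ true
    free-pair x y with free A x in fx | free A y in fy
    ... | true  | true  = IsF₂.free-connected F₂ x y fx fy
    ... | true  | false = refl
    ... | false | _     = refl

  module Insertion {A : Subset m} {e : Fin m} (e∉A : ¬ (e ∈ A)) where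
    A⁺ : Subset m
    A⁺ = A [ e ]≔ true

    private
      a b : Fin n
      a = end₁ e
      b = end₂ e

    ¬conn-ab : conn A a b ≡ false
    ¬conn-ab = ¬conn-ends e e∉A

    conn-insert : ∀ y s → conn A⁺ y s ≡ connVia A e y s
    conn-insert = conn-extend (Extends-insert e∉A)

    conn-insert⁺ : ∀ {x y} → conn A x y ≡ true → conn A⁺ x y ≡ true
    conn-insert⁺ = conn-mono (Extends.A⊆B (Extends-insert e∉A))

    Rooted : Subset m → Set
    Rooted B = ∀ x → sCount B x ≡ 1

    ¬both-free : Rooted A⁺ → free A a ≡ true → free A b ≡ true → ⊥
    ¬both-free rooted fa fb = case trans (sym (rooted a)) (trans (countFin-cong n unrooted) (countFin-false n)) of λ ()
      where
      unrooted : ∀ s → inS s ∧ conn A⁺ a s ≡ false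
      unrooted s rewrite conn-insert a s | ¬conn-ab with inS s in s∈S
      ... | false = refl
      ... | true rewrite free⇒¬conn fa s∈S | free⇒¬conn fb s∈S | Boolₚ.∧-zeroʳ (conn A a a) = refl

    ¬both-rooted : Rooted A⁺ → free A a ≡ false → free A b ≡ false → ⊥
    ¬both-rooted rooted ¬fa ¬fb = true≢false a~b ¬conn-ab
      where
      sa = proj₁ (¬free⇒conn ¬fa)
      sb = proj₁ (¬free⇒conn ¬fb)
      a~sa = ∧≡true {inS sa} (proj₂ (¬free⇒conn ¬fa))
      b~sb = ∧≡true {inS sb} (proj₂ (¬free⇒conn ¬fb))
      a~sb⁺ : conn A⁺ a sb ≡ true
      a~sb⁺ rewrite conn-insert a sb | conn-refl A a | proj₂ b~sb = Boolₚ.∨-zeroʳ (conn A a sb)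
      sa≡sb : sa ≡ sb
      sa≡sb = countFin≡1⇒unique n _ (rooted a) (∧-intro (proj₁ a~sa) (conn-insert⁺ (proj₂ a~sa)))
                                               (∧-intro (proj₁ b~sb) a~sb⁺)
      a~b : conn A a b ≡ true
      a~b = conn-trans (proj₂ a~sa) (trans (conn-sym A sa b) (subst (λ s → conn A b s ≡ true) (sym sa≡sb) (proj₂ b~sb)))

    free-attached : Rooted A⁺ → ∀ x → free A x ≡ true → conn A x a ≡ true ⊎ conn A x b ≡ true
    free-attached rooted x fx with countFin≡suc⇒ n (λ s → inS s ∧ conn A⁺ x s) (rooted x)
    ... | s , x~s with ∧≡true {inS s} x~s
    ...   | s∈S , x~s⁺ rewrite conn-insert x s | free⇒¬conn fx s∈S with ∨≡true x~s⁺
    ...     | inj₁ via-a = inj₁ (proj₁ (∧≡true via-a))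
    ...     | inj₂ via-b = inj₂ (proj₁ (∧≡true via-b))

    rooted⇒F₂ : Rooted A⁺ → IsF₂ A
    rooted⇒F₂ rooted = record
      { sCount≤1       = λ x → ℕₚ.≤-trans (countFin-mono n _ _ (λ s h → let s∈S , x~s = ∧≡true {inS s} h
                                                                           in ∧-intro s∈S (conn-insert⁺ x~s)))
                                           (ℕₚ.≤-reflexive (rooted x))
      ; floating       = proj₁ some-free
      ; floating-free  = proj₂ some-free
      ; free-connected = connected-free
      }
      where
      some-free : Σ (Fin n) (λ z → free A z ≡ true)
      some-free with free A a in fa | free A b in fb
      ... | true  | _     = a , fa
      ... | false | true  = b , fb
      ... | false | false = ⊥-elim (¬both-rooted rooted fa fb)
      connected-free : ∀ x y → free A x ≡ true → free A y ≡ true → conn A x y ≡ true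
      connected-free x y fx fy with free-attached rooted x fx | free-attached rooted y fy
      ... | inj₁ xa | inj₁ ya = conn-trans xa (trans (conn-sym A _ _) ya)
      ... | inj₂ xb | inj₂ yb = conn-trans xb (trans (conn-sym A _ _) yb)
      ... | inj₁ xa | inj₂ yb = ⊥-elim (¬both-free rooted (trans (sym (free-resp xa)) fx) (trans (sym (free-resp yb)) fy))
      ... | inj₂ xb | inj₁ ya = ⊥-elim (¬both-free rooted (trans (sym (free-resp ya)) fy) (trans (sym (free-resp xb)) fx))

    rooted⇒boundary : Rooted A⁺ → boundary A e ≡ true
    rooted⇒boundary rooted with free A a in fa | free A b in fb
    ... | true  | true  = ⊥-elim (¬both-free rooted fa fb)
    ... | true  | false = refl
    ... | false | true  = refl
    ... | false | false = ⊥-elim (¬both-rooted rooted fa fb)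

    -- p is the free end of e and q the rooted one; the hypothesis on conn A⁺ is connVia up to the order of the ends.
    attach-free : IsF₂ A → ∀ p q → free A p ≡ true → free A q ≡ false →
                  (∀ y s → conn A⁺ y s ≡ (conn A y s ∨ (conn A y p ∧ conn A q s) ∨ (conn A y q ∧ conn A p s))) →
                  Rooted A⁺
    attach-free F₂ p q fp ¬fq conn⁺ y with free A y in fy
    ... | true  = trans (countFin-cong n via-q) (¬free⇒sCount≡1 (IsF₂.sCount≤1 F₂ q) ¬fq)
      where
      yp : conn A y p ≡ true
      yp = IsF₂.free-connected F₂ y p fy fp
      ¬yq : conn A y q ≡ false
      ¬yq with conn A y q in yq
      ... | false = refl
      ... | true  = ⊥-elim (true≢false (trans (sym (free-resp yq)) fy) ¬fq)
      via-q : ∀ s → inS s ∧ conn A⁺ y s ≡ inS s ∧ conn A q s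
      via-q s rewrite conn⁺ y s | yp | ¬yq with inS s in s∈S
      ... | false = refl
      ... | true rewrite free⇒¬conn fy s∈S = Boolₚ.∨-identityʳ _
    ... | false = trans (countFin-cong n unchanged) (¬free⇒sCount≡1 (IsF₂.sCount≤1 F₂ y) fy)
      where
      ¬yp : conn A y p ≡ false
      ¬yp with conn A y p in yp
      ... | false = refl
      ... | true  = ⊥-elim (true≢false (trans (free-resp yp) fp) fy)
      unchanged : ∀ s → inS s ∧ conn A⁺ y s ≡ inS s ∧ conn A y s
      unchanged s rewrite conn⁺ y s | ¬yp with inS s in s∈S
      ... | false = refl
      ... | true rewrite free⇒¬conn fp s∈S | Boolₚ.∧-zeroʳ (conn A y q) = Boolₚ.∨-identityʳ _

    F₂⇒rooted : IsF₂ A → boundary A e ≡ true → Rooted A⁺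
    F₂⇒rooted F₂ leaves with free A a in fa | free A b in fb
    ... | true  | false = attach-free F₂ a b fa fb conn-insert
    ... | false | true  = attach-free F₂ b a fb fa (λ y s → trans (conn-insert y s)
                            (cong (conn A y s ∨_) (Boolₚ.∨-comm (conn A y a ∧ conn A b s) (conn A y b ∧ conn A a s))))

    isF₁-insert : isF₁ A⁺ ≡ isF₂ A ∧ boundary A e
    isF₁-insert = ≡true-ext to from
      where
      to : isF₁ A⁺ ≡ true → isF₂ A ∧ boundary A e ≡ true
      to h = ∧-intro (isF₂⇐ (rooted⇒F₂ (isF₁⇒ h))) (rooted⇒boundary (isF₁⇒ h))
      from : isF₂ A ∧ boundary A e ≡ true → isF₁ A⁺ ≡ true
      from h = let F₂ , leaves = ∧≡true {isF₂ A} h in isF₁⇐ (F₂⇒rooted (isF₂⇒ F₂) leaves)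

module FloatingComponent {c ℓ} (R : CommutativeRing c ℓ) {n m : ℕ} {G : Graph n m} (tree : IsTree G)
                         (conn? : ∀ A u v → Dec (Walk G A u v))
                         (acyc? : ∀ A → Dec (Acyclic G A)) (S : Subset n) (u : Fin n) where
  open CommutativeRing R renaming (refl to ≈-refl; sym to ≈-sym; trans to ≈-trans)
  open RingSums R
  open RingSumProperties R
  open RingProperties ring using (x[y-z]≈xy-xz; [y-z]x≈yx-zx)
  open Separation R tree conn? u public
  open ForestClasses tree conn? acyc? S public
  open import Relation.Binary.Reasoning.Setoid setoid

  outdeg* : Subset m → ℕ
  outdeg* F = countFin m (boundary F)

  κ : Subset m → Carrier
  κ F = two - fromℕ (outdeg* F)

  τ-free : Subset m → Carrier
  τ-free F = sumFin n (λ x → [ free F x ] * τ x)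

  τ-free-separated : Subset m → Fin m → Carrier
  τ-free-separated F e = sumFin n (λ x → [ free F x ∧ separates e x ] * τ x)

  correction : Subset m → Fin m → Carrier
  correction F e = τ-free F - two * τ-free-separated F e

  boundary-Joins : ∀ {F f y w} → Joins G f y w → boundary F f ≡ (free F y xor free F w)
  boundary-Joins (inj₁ refl) = refl
  boundary-Joins {F} {y = y} {w} (inj₂ refl) = Boolₚ.xor-comm (free F w) (free F y)

  module Floating {F : Subset m} (F₂ : IsF₂ F) (u∈S : inS u ≡ true) where
    open IsF₂ F₂

    x₀ : Fin n
    x₀ = floating

    free≡conn : ∀ x → free F x ≡ conn F x₀ x
    free≡conn x = ≡true-ext (free-connected x₀ x floating-free) (λ x₀x → trans (sym (free-resp x₀x)) floating-free)

    -- The unique path to x₀ from a free vertex runs inside F.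
    boundary-free-path : ∀ {y} (q : Walk G E y x₀) → IsPath G q → free F y ≡ true →
                         countList (boundary F) (walkEdges G q) ≡ 0
    boundary-free-path {y} q q-path fy = countList≡0 (boundary F) _ (λ f∈q →
        boundary-∈ (walkEdges⊆ r (subst (_ ∈ₗ_) (path-unique q r q-path r-path) f∈q)))
      where
      r = proj₁ (toPath (conn⇒walk (free-connected y x₀ fy floating-free)))
      r-path = proj₂ (toPath (conn⇒walk (free-connected y x₀ fy floating-free)))

    boundary-rooted-path : ∀ {y} (q : Walk G E y x₀) → IsPath G q → free F y ≡ false →
                           countList (boundary F) (walkEdges G q) ≡ 1
    boundary-rooted-path []                   _              ¬fy = ⊥-elim (true≢false floating-free ¬fy)
    boundary-rooted-path (step {w = w} f _ j r) (_ ∷ r-path) ¬fy with free F w in fw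
    ... | true  = cong₂ ℕ._+_ crossing (boundary-free-path r r-path fw)
      where crossing : (if boundary F f then 1 else 0) ≡ 1
            crossing rewrite boundary-Joins {F} j | ¬fy | fw = refl
    ... | false = cong₂ ℕ._+_ no-crossing (boundary-rooted-path r r-path fw)
      where no-crossing : (if boundary F f then 1 else 0) ≡ 0
            no-crossing rewrite boundary-Joins {F} j | ¬fy | fw = refl

    boundary-separating : countFin m (λ e → boundary F e ∧ separates e x₀) ≡ 1
    boundary-separating =
      trans (countFin-cong m (λ e → cong (boundary F e ∧_) (sym (path-separates p p-path e))))
      (trans (countFin-Unique (boundary F) (walkEdges G p) (path⇒walkEdges-unique p p-path))
             (boundary-rooted-path p p-path (conn⇒¬free u (∧-intro u∈S (conn-refl F u)))))
      where
      p = proj₁ (toPath (connected u x₀))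
      p-path = proj₂ (toPath (connected u x₀))

    τ-floating : τ-free F ≈ κ F
    τ-floating = begin
      τ-free F                                      ≈⟨ sumFin-cong n (λ x → []-cong (free≡conn x) (τ x)) ⟩
      sumFin n (λ x → [ conn F x₀ x ] * τ x)       ≈⟨ τ-sum F x₀ ⟩
      two - fromℕ (outdeg F x₀)                     ≡⟨ cong (λ k → two - fromℕ k) (countFin-cong m (λ e →
                                                         sym (cong₂ _xor_ (free≡conn (end₁ e)) (free≡conn (end₂ e))))) ⟩
      κ F                                           ∎

    τ-floating-separated : ∀ e → ¬ (e ∈ F) → τ-free-separated F e ≈ [ separates e x₀ ] * κ F
    τ-floating-separated e e∉F = begin
      τ-free-separated F e                              ≈⟨ sumFin-cong n (λ x → []-cong (same-side x) (τ x)) ⟩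
      sumFin n (λ x → [ separates e x₀ ∧ free F x ] * τ x) ≈⟨ sumFin-cong n (λ x → ≈-trans (*-congʳ ([∧]≈[]*[] _ _)) (*-assoc _ _ _)) ⟩
      sumFin n (λ x → [ separates e x₀ ] * ([ free F x ] * τ x)) ≈⟨ *-distribˡ-sumFin n _ _ ⟨
      [ separates e x₀ ] * τ-free F                     ≈⟨ *-congˡ τ-floating ⟩
      [ separates e x₀ ] * κ F                          ∎
      where
      same-side : ∀ x → free F x ∧ separates e x ≡ separates e x₀ ∧ free F x
      same-side x with free F x in fx
      ... | false = sym (Boolₚ.∧-zeroʳ _)
      ... | true  = trans (sym (separates-resp (conn-mono (⊆E∖ e∉F) (trans (sym (free≡conn x)) fx))))
                          (sym (Boolₚ.∧-identityʳ _))

    correction-boundary : ∀ e → [ boundary F e ] * correction F e ≈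
                                [ boundary F e ] * κ F - two * ([ boundary F e ∧ separates e x₀ ] * κ F)
    correction-boundary e with boundary F e in leaves
    ... | false = begin
      0# * correction F e                ≈⟨ zeroˡ _ ⟩
      0#                                 ≈⟨ -‿inverseʳ 0# ⟨
      0# - 0#                            ≈⟨ +-cong (zeroˡ _) (-‿cong (≈-trans (*-congˡ (zeroˡ _)) (zeroʳ two))) ⟨
      0# * κ F - two * (0# * κ F)        ∎
    ... | true  = begin
      1# * correction F e                                    ≈⟨ *-identityˡ _ ⟩
      τ-free F - two * τ-free-separated F e                  ≈⟨ +-cong τ-floating (-‿cong (*-congˡ (τ-floating-separated e e∉F))) ⟩
      κ F - two * ([ separates e x₀ ] * κ F)                 ≈⟨ +-congʳ (*-identityˡ _) ⟨
      1# * κ F - two * ([ separates e x₀ ] * κ F)            ∎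
      where e∉F : ¬ (e ∈ F)
            e∉F e∈F = true≢false leaves (boundary-∈ e∈F)

    -- Exactly one boundary edge separates the floating component from u.
    sum-boundary-corrections : sumFin m (λ e → [ boundary F e ] * correction F e) ≈ - (κ F * κ F)
    sum-boundary-corrections = begin
      sumFin m (λ e → [ boundary F e ] * correction F e)
        ≈⟨ ≈-trans (sumFin-cong m correction-boundary) (sumFin-minus m _ _) ⟩
      sumFin m (λ e → [ boundary F e ] * κ F) - sumFin m (λ e → two * ([ boundary F e ∧ separates e x₀ ] * κ F))
        ≈⟨ +-cong (≈-sym (*-distribʳ-sumFin m _ _))
                  (-‿cong (≈-trans (≈-sym (*-distribˡ-sumFin m two _)) (*-congˡ (≈-sym (*-distribʳ-sumFin m _ _))))) ⟩
      sumFin m (λ e → [ boundary F e ]) * κ F - two * (sumFin m (λ e → [ boundary F e ∧ separates e x₀ ]) * κ F)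
        ≈⟨ +-cong (*-congʳ (fromℕ-countFin m _)) (-‿cong (*-congˡ (*-congʳ (fromℕ-countFin m _)))) ⟨
      fromℕ (outdeg* F) * κ F - two * (fromℕ (countFin m (λ e → boundary F e ∧ separates e x₀)) * κ F)
        ≡⟨ cong (λ k → fromℕ (outdeg* F) * κ F - two * (fromℕ k * κ F)) boundary-separating ⟩
      fromℕ (outdeg* F) * κ F - two * ((1# + 0#) * κ F)
        ≈⟨ +-congˡ (-‿cong (*-congˡ (≈-trans (*-congʳ (+-identityʳ 1#)) (*-identityˡ _)))) ⟩
      fromℕ (outdeg* F) * κ F - two * κ F
        ≈⟨ x[y-x]-y[y-x]≈-[y-x]² _ _ ⟩
      - (κ F * κ F) ∎

  -- s is the root of x in T, and free (T [ e ]≔ false) x says that removing e cuts x off from s.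
  root-separates : ∀ {T} → isF₁ T ≡ true → ∀ e x s → inS s ∧ conn T x s ≡ true →
                   separates e s ≡ (lookup T e ∧ free (T [ e ]≔ false) x) xor separates e x
  root-separates {T} T∈F₁ e x s x~s with ∧≡true {inS s} x~s | lookup T e in e∈T
  ... | s∈S , xs | false = sym (separates-resp (conn-mono (⊆E∖ (λ e∈T′ → true≢false (∈⇒lookup e∈T′) e∈T)) xs))
  ... | s∈S , xs | true with free (T [ e ]≔ false) x in fx
  ...   | true  = separates-flip ¬xs
    where
    T⁻∩E∖⊆T⁻ : ∀ {f} → f ∈ T → f ∈ E∖ e → f ∈ (T [ e ]≔ false)
    T⁻∩E∖⊆T⁻ f∈T f∈E∖e with ∈-update⁻ f∈E∖e
    ... | inj₂ (f≢e , _) = ∈-update⁺ f≢e f∈T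
    ¬xs : conn (E∖ e) x s ≡ false
    ¬xs with conn (E∖ e) x s in xs-E∖
    ... | false = refl
    ... | true  = ⊥-elim (true≢false (conn-meet T⁻∩E∖⊆T⁻ xs xs-E∖) (free⇒¬conn fx s∈S))
  ...   | false = sym (separates-resp (conn-mono (⊆E∖ (∉-update-false T e)) x~s⁻))
    where
    s′ = proj₁ (¬free⇒conn fx)
    x~s′ = ∧≡true {inS s′} (proj₂ (¬free⇒conn fx))
    s′≡s : s′ ≡ s
    s′≡s = countFin≡1⇒unique n _ (isF₁⇒ T∈F₁ x)
             (∧-intro (proj₁ x~s′) (conn-mono (Extends.A⊆B (Extends-remove (lookup⇒∈ e∈T))) (proj₂ x~s′))) x~s
    x~s⁻ : conn (T [ e ]≔ false) x s ≡ true
    x~s⁻ = subst (λ z → conn (T [ e ]≔ false) x z ≡ true) s′≡s (proj₂ x~s′)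

  rootSeparation : Subset m → Fin m → Fin n → Carrier
  rootSeparation T e x = sumFin n (λ v → [ inS v ∧ conn T x v ] * [ separates e v ])

  rootSeparation-value : ∀ {T} → isF₁ T ≡ true → ∀ e x →
                         rootSeparation T e x ≈ [ (lookup T e ∧ free (T [ e ]≔ false) x) xor separates e x ]
  rootSeparation-value T∈F₁ e x =
    ≈-trans (sumFin-unique n _ (λ v → [ separates e v ]) s (isF₁⇒ T∈F₁ x) x~s)
            (reflexive (cong [_] (root-separates T∈F₁ e x s x~s)))
    where
    s = proj₁ (countFin≡suc⇒ n _ (isF₁⇒ T∈F₁ x))
    x~s = proj₂ (countFin≡suc⇒ n _ (isF₁⇒ T∈F₁ x))

  τ-rootSeparation : ∀ {T} → isF₁ T ≡ true → ∀ e →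
                     sumFin n (λ x → τ x * rootSeparation T e x) ≈ 1# + [ lookup T e ] * correction (T [ e ]≔ false) e
  τ-rootSeparation {T} T∈F₁ e = begin
    sumFin n (λ x → τ x * rootSeparation T e x)
      ≈⟨ sumFin-cong n (λ x → ≈-trans (*-congˡ (rootSeparation-value T∈F₁ e x)) (*-comm _ _)) ⟩
    sumFin n (λ x → [ cut x xor separates e x ] * τ x)
      ≈⟨ sumFin-cong n (λ x → ≈-trans (*-congʳ ([xor]≈[]+[]-2[∧] (cut x) (separates e x)))
                                (≈-trans ([y-z]x≈yx-zx (τ x) _ _) (+-cong (distribʳ (τ x) _ _) (-‿cong (*-assoc _ _ _))))) ⟩
    sumFin n (λ x → ([ separates e x ] * τ x + [ cut x ] * τ x) - two * ([ cut x ∧ separates e x ] * τ x))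
      ≈⟨ ≈-trans (sumFin-minus n _ _) (+-cong (sumFin-+ n _ _) (-‿cong (≈-sym (*-distribˡ-sumFin n two _)))) ⟩
    (sumFin n (λ x → [ separates e x ] * τ x) + sumFin n (λ x → [ cut x ] * τ x))
      - two * sumFin n (λ x → [ cut x ∧ separates e x ] * τ x)
      ≈⟨ +-cong (+-cong (τ-sum-separated e) cut-free) (-‿cong (*-congˡ cut-free-separated)) ⟩
    (1# + [ L ] * τ-free T⁻) - two * ([ L ] * τ-free-separated T⁻ e)
      ≈⟨ +-assoc _ _ _ ⟩
    1# + ([ L ] * τ-free T⁻ - two * ([ L ] * τ-free-separated T⁻ e))
      ≈⟨ +-congˡ (+-congˡ (-‿cong (x∙yz≈y∙xz two [ L ] _))) ⟩
    1# + ([ L ] * τ-free T⁻ - [ L ] * (two * τ-free-separated T⁻ e))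
      ≈⟨ +-congˡ (x[y-z]≈xy-xz _ _ _) ⟨
    1# + [ L ] * correction T⁻ e ∎
    where
    open CommutativeSemigroupProperties *-commutativeSemigroup using (x∙yz≈y∙xz)
    L = lookup T e
    T⁻ = T [ e ]≔ false
    cut : Fin n → Bool
    cut x = L ∧ free T⁻ x
    cut-free : sumFin n (λ x → [ cut x ] * τ x) ≈ [ L ] * τ-free T⁻
    cut-free = ≈-trans (sumFin-cong n (λ x → ≈-trans (*-congʳ ([∧]≈[]*[] L _)) (*-assoc _ _ _)))
                       (≈-sym (*-distribˡ-sumFin n _ _))
    cut-free-separated : sumFin n (λ x → [ cut x ∧ separates e x ] * τ x) ≈ [ L ] * τ-free-separated T⁻ e
    cut-free-separated =
      ≈-trans (sumFin-cong n (λ x → ≈-trans (*-congʳ (≈-trans (reflexive (cong [_] (Boolₚ.∧-assoc L _ _))) ([∧]≈[]*[] L _)))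
                                            (*-assoc _ _ _)))
              (≈-sym (*-distribˡ-sumFin n _ _))

  α-rootSeparation : ∀ (α : Fin m → Carrier) {T} → isF₁ T ≡ true →
                     sumFin m (λ e → α e * sumFin n (λ x → τ x * rootSeparation T e x)) ≈
                     sumFin m α + sumFin m (λ e → [ lookup T e ] * (α e * correction (T [ e ]≔ false) e))
  α-rootSeparation α {T} T∈F₁ = ≈-trans (sumFin-cong m per-edge) (sumFin-+ m _ _)
    where
    open CommutativeSemigroupProperties *-commutativeSemigroup using (x∙yz≈y∙xz)
    per-edge : ∀ e → α e * sumFin n (λ x → τ x * rootSeparation T e x) ≈
                     α e + [ lookup T e ] * (α e * correction (T [ e ]≔ false) e)
    per-edge e = ≈-trans (*-congˡ (τ-rootSeparation T∈F₁ e))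
                         (≈-trans (distribˡ _ _ _) (+-cong (*-identityʳ _) (x∙yz≈y∙xz _ _ _)))

  insertable≡ : ∀ F e → not (lookup F e) ∧ isF₁ (F [ e ]≔ true) ≡ isF₂ F ∧ boundary F e
  insertable≡ F e with lookup F e in e∈F
  ... | true  = sym (trans (cong (isF₂ F ∧_) (boundary-∈ (lookup⇒∈ e∈F))) (Boolₚ.∧-zeroʳ _))
  ... | false = Insertion.isF₁-insert (λ e∈F′ → true≢false (∈⇒lookup e∈F′) e∈F)

  sum-F₂-corrections : inS u ≡ true → ∀ F →
                       sumFin m (λ e → [ isF₂ F ∧ boundary F e ] * correction F e) ≈ (if isF₂ F then - (κ F * κ F) else 0#)
  sum-F₂-corrections u∈S F with isF₂ F in F∈F₂
  ... | true  = Floating.sum-boundary-corrections (isF₂⇒ F∈F₂) u∈S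
  ... | false = ≈-trans (sumFin-cong m (λ e → zeroˡ _)) (sumFin-0 m)

module Assembly {c ℓ} (R : CommutativeRing c ℓ) {n m : ℕ} {G : Graph n m} (tree : IsTree G)
                (α : Fin m → CommutativeRing.Carrier R) (D : Fin n → Fin n → CommutativeRing.Carrier R)
                (D-paths : ∀ u v (p : Walk G (fullSet G) u v) → IsPath G p →
                           CommutativeRing._≈_ R (D u v) (RingSums.sumList R (walkEdges G p) α))
                (S : Subset n) (conn? : ∀ A u v → Dec (Walk G A u v)) (acyc? : ∀ A → Dec (Acyclic G A))
                (u : Fin n) where
  open CommutativeRing R renaming (refl to ≈-refl; sym to ≈-sym; trans to ≈-trans)
  open RingSums R
  open RingSumProperties R
  open Forests G α S conn? acyc? using (w; mvec)
  open FloatingComponent R tree conn? acyc? S u public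
  open CommutativeMonoidSolver *-commutativeMonoid using (solve; _⊜_; _⊕_)
  open RingProperties ring using (-‿distribʳ-*)
  open GroupProperties +-group using (ε⁻¹≈ε)
  open import Relation.Binary.Reasoning.Setoid setoid

  subsets : List (Subset m)
  subsets = allSubsets m

  τ-component : Subset m → Fin n → Carrier
  τ-component T v = sumFin n (λ x → [ conn T v x ] * τ x)

  treeTerm : Subset m → Carrier
  treeTerm T = [ isF₁ T ] * (w T * sumFin m (λ e → α e * sumFin n (λ x → τ x * rootSeparation T e x)))

  insertionTerm : Fin m → Subset m → Carrier
  insertionTerm e T = [ isF₁ T ] * (w T * (α e * correction (T [ e ]≔ false) e))

  mvec≈ : ∀ v → mvec v ≈ sumList subsets (λ T → [ isF₁ T ] * (w T * τ-component T v))
  mvec≈ v = sumList-cong subsets (λ T → ≈-trans (if-then-0≈[]* (isF₁ T) _) (*-congˡ (*-congˡ (≈-sym (τ-sum T v)))))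

  component-distance : ∀ T → sumFin n (λ v → [ inS v ] * (D u v * τ-component T v)) ≈
                             sumFin m (λ e → α e * sumFin n (λ x → τ x * rootSeparation T e x))
  component-distance T = begin
    sumFin n (λ v → [ inS v ] * (D u v * τ-component T v))
      ≈⟨ sumFin-cong n (λ v → *-congˡ (*-congʳ (distance-as-sum α D D-paths v))) ⟩
    sumFin n (λ v → [ inS v ] * (sumFin m (λ e → [ separates e v ] * α e) * τ-component T v))
      ≈⟨ sumFin-cong n (λ v → *-sumFin-*-sumFin m n _ _ _) ⟩
    sumFin n (λ v → sumFin m (λ e → sumFin n (λ x → term v e x)))
      ≈⟨ ≈-trans (sumFin-swap n m _) (sumFin-cong m (λ e → sumFin-swap n n _)) ⟩
    sumFin m (λ e → sumFin n (λ x → sumFin n (λ v → term v e x)))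
      ≈⟨ sumFin-cong m (λ e → sumFin-cong n (λ x → sumFin-cong n (λ v → rearrange v e x))) ⟩
    sumFin m (λ e → sumFin n (λ x → sumFin n (λ v → α e * (τ x * ([ inS v ∧ conn T x v ] * [ separates e v ])))))
      ≈⟨ sumFin-cong m (λ e → ≈-trans (sumFin-cong n (λ x → ≈-trans (≈-sym (*-distribˡ-sumFin n _ _))
                                                                      (*-congˡ (≈-sym (*-distribˡ-sumFin n _ _)))))
                                      (≈-sym (*-distribˡ-sumFin n _ _))) ⟩
    sumFin m (λ e → α e * sumFin n (λ x → τ x * rootSeparation T e x)) ∎
    where
    term : Fin n → Fin m → Fin n → Carrier
    term v e x = [ inS v ] * (([ separates e v ] * α e) * ([ conn T v x ] * τ x))
    rearrange : ∀ v e x → term v e x ≈ α e * (τ x * ([ inS v ∧ conn T x v ] * [ separates e v ]))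
    rearrange v e x = ≈-trans
      (solve 5 (λ s p a c t → (s ⊕ ((p ⊕ a) ⊕ (c ⊕ t))) ⊜ (a ⊕ (t ⊕ ((s ⊕ c) ⊕ p)))) ≈-refl
             [ inS v ] [ separates e v ] (α e) [ conn T v x ] (τ x))
      (*-congˡ (*-congˡ (*-congʳ (≈-sym (≈-trans ([∧]≈[]*[] (inS v) _) (*-congˡ (reflexive (cong [_] (conn-sym T x v)))))))))

  distance-weighted-sum : sumFin n (λ v → if v ∈ᵇ S then D u v * mvec v else 0#) ≈ sumList subsets treeTerm
  distance-weighted-sum = begin
    sumFin n (λ v → if v ∈ᵇ S then D u v * mvec v else 0#)
      ≈⟨ sumFin-cong n (λ v → ≈-trans (if-then-0≈[]* (inS v) _) (*-congˡ (*-congˡ (mvec≈ v)))) ⟩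
    sumFin n (λ v → [ inS v ] * (D u v * sumList subsets (λ T → [ isF₁ T ] * (w T * τ-component T v))))
      ≈⟨ sumFin-cong n distribute ⟩
    sumFin n (λ v → sumList subsets (λ T → [ isF₁ T ] * (w T * ([ inS v ] * (D u v * τ-component T v)))))
      ≈⟨ sumList-sumFin-swap subsets n _ ⟨
    sumList subsets (λ T → sumFin n (λ v → [ isF₁ T ] * (w T * ([ inS v ] * (D u v * τ-component T v)))))
      ≈⟨ sumList-cong subsets (λ T → ≈-sym (≈-trans (*-congˡ (*-distribˡ-sumFin n _ _)) (*-distribˡ-sumFin n _ _))) ⟩
    sumList subsets (λ T → [ isF₁ T ] * (w T * sumFin n (λ v → [ inS v ] * (D u v * τ-component T v))))
      ≈⟨ sumList-cong subsets (λ T → *-congˡ (*-congˡ (component-distance T))) ⟩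
    sumList subsets treeTerm ∎
    where
    distribute : ∀ v → [ inS v ] * (D u v * sumList subsets (λ T → [ isF₁ T ] * (w T * τ-component T v))) ≈
                       sumList subsets (λ T → [ isF₁ T ] * (w T * ([ inS v ] * (D u v * τ-component T v))))
    distribute v = ≈-trans (*-congˡ (*-distribˡ-sumList subsets _ _))
                   (≈-trans (*-distribˡ-sumList subsets _ _)
                   (sumList-cong subsets (λ T → solve 5 (λ s d f w c → (s ⊕ (d ⊕ (f ⊕ (w ⊕ c)))) ⊜ (f ⊕ (w ⊕ (s ⊕ (d ⊕ c))))) ≈-refl
                                                       [ inS v ] (D u v) [ isF₁ T ] (w T) (τ-component T v))))

  treeTerm-split : ∀ T → treeTerm T ≈ sumFin m α * ([ isF₁ T ] * w T) + sumFin m (λ e → [ lookup T e ] * insertionTerm e T)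
  treeTerm-split T = by-membership (isF₁ T) refl
    where
    split-rhs : Carrier
    split-rhs = sumFin m α * ([ isF₁ T ] * w T) + sumFin m (λ e → [ lookup T e ] * insertionTerm e T)
    by-membership : ∀ b → isF₁ T ≡ b → treeTerm T ≈ split-rhs
    by-membership false T∉F₁ = ≈-trans (vanish _) (≈-sym (≈-trans
      (+-cong (≈-trans (*-congˡ (vanish _)) (zeroʳ _))
              (≈-trans (sumFin-cong m (λ e → ≈-trans (*-congˡ (vanish _)) (zeroʳ _))) (sumFin-0 m)))
      (+-identityˡ 0#)))
      where vanish : ∀ x → [ isF₁ T ] * x ≈ 0#
            vanish x = ≈-trans ([]-cong T∉F₁ x) (zeroˡ x)
    by-membership true T∈F₁ = begin
      treeTerm T
        ≈⟨ ≈-trans (keep _) (*-congˡ (α-rootSeparation α T∈F₁)) ⟩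
      w T * (sumFin m α + sumFin m (λ e → [ lookup T e ] * (α e * correction (T [ e ]≔ false) e)))
        ≈⟨ distribˡ _ _ _ ⟩
      w T * sumFin m α + w T * sumFin m (λ e → [ lookup T e ] * (α e * correction (T [ e ]≔ false) e))
        ≈⟨ +-cong (≈-trans (*-comm _ _) (*-congˡ (≈-sym (keep _))))
                  (≈-trans (*-distribˡ-sumFin m _ _) (sumFin-cong m (λ e → x∙yz≈y∙xz (w T) [ lookup T e ] _))) ⟩
      sumFin m α * ([ isF₁ T ] * w T) + sumFin m (λ e → [ lookup T e ] * (w T * (α e * correction (T [ e ]≔ false) e)))
        ≈⟨ +-congˡ (sumFin-cong m (λ e → *-congˡ (≈-sym (keep _)))) ⟩
      split-rhs ∎
      where keep : ∀ x → [ isF₁ T ] * x ≈ x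
            keep x = ≈-trans ([]-cong T∈F₁ x) (*-identityˡ x)
            open CommutativeSemigroupProperties *-commutativeSemigroup using (x∙yz≈y∙xz)

  w-insert : ∀ F e → lookup F e ≡ false → w F ≈ α e * w (F [ e ]≔ true)
  w-insert F e e∉F = ≈-trans (prodFin-extract m weight e) (*-cong weight-e (prodFin-cong m rest))
    where
    weight : Fin m → Carrier
    weight f = if f ∈ᵇ F then 1# else α f
    weight-e : weight e ≈ α e
    weight-e rewrite ∈ᵇ≡lookup e F | e∉F = ≈-refl
    rest : ∀ f → (if ⌊ f Finₚ.≟ e ⌋ then 1# else weight f) ≈ (if f ∈ᵇ (F [ e ]≔ true) then 1# else α f)
    rest f rewrite ∈ᵇ≡lookup f (F [ e ]≔ true) | lookup-update F e f true | ∈ᵇ≡lookup f F with f Finₚ.≟ e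
    ... | yes _ = ≈-refl
    ... | no  _ = ≈-refl

  insert-remove : ∀ (F : Subset m) e → lookup F e ≡ false → (F [ e ]≔ true) [ e ]≔ false ≡ F
  insert-remove F e e∉F = trans (Vecₚ.[]≔-idempotent F e) (trans (cong (F [ e ]≔_) (sym e∉F)) (Vecₚ.[]≔-lookup F e))

  insertionTerm-insert : ∀ F e → [ not (lookup F e) ] * insertionTerm e (F [ e ]≔ true) ≈
                                 [ isF₂ F ∧ boundary F e ] * (w F * correction F e)
  insertionTerm-insert F e = ≈-trans (reinsert (lookup F e) refl) ([]-cong (insertable≡ F e) _)
    where
    F⁺ = F [ e ]≔ true
    reinsert : ∀ b → lookup F e ≡ b → [ not b ] * insertionTerm e F⁺ ≈ [ not b ∧ isF₁ F⁺ ] * (w F * correction F e)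
    reinsert true  _   = ≈-trans (zeroˡ _) (≈-sym (zeroˡ _))
    reinsert false e∉F = begin
      1# * ([ isF₁ F⁺ ] * (w F⁺ * (α e * correction (F⁺ [ e ]≔ false) e)))
        ≡⟨ cong (λ Z → 1# * ([ isF₁ F⁺ ] * (w F⁺ * (α e * correction Z e)))) (insert-remove F e e∉F) ⟩
      1# * ([ isF₁ F⁺ ] * (w F⁺ * (α e * correction F e)))
        ≈⟨ ≈-trans (*-identityˡ _) (solve 4 (λ f w a g → (f ⊕ (w ⊕ (a ⊕ g))) ⊜ (f ⊕ ((a ⊕ w) ⊕ g))) ≈-refl
                                            [ isF₁ F⁺ ] (w F⁺) (α e) (correction F e)) ⟩
      [ isF₁ F⁺ ] * ((α e * w F⁺) * correction F e)
        ≈⟨ *-congˡ (*-congʳ (w-insert F e e∉F)) ⟨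
      [ isF₁ F⁺ ] * (w F * correction F e) ∎

  sum-insertionTerms : ∀ F → inS u ≡ true →
                 sumFin m (λ e → [ not (lookup F e) ] * insertionTerm e (F [ e ]≔ true)) ≈
                 - (if isF₂ F then w F * (κ F * κ F) else 0#)
  sum-insertionTerms F u∈S = begin
    sumFin m (λ e → [ not (lookup F e) ] * insertionTerm e (F [ e ]≔ true))
      ≈⟨ sumFin-cong m (insertionTerm-insert F) ⟩
    sumFin m (λ e → [ isF₂ F ∧ boundary F e ] * (w F * correction F e))
      ≈⟨ ≈-trans (sumFin-cong m (λ e → x∙yz≈y∙xz _ _ _)) (≈-sym (*-distribˡ-sumFin m _ _)) ⟩
    w F * sumFin m (λ e → [ isF₂ F ∧ boundary F e ] * correction F e)
      ≈⟨ *-congˡ (sum-F₂-corrections u∈S F) ⟩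
    w F * (if isF₂ F then - (κ F * κ F) else 0#)
      ≈⟨ negate (isF₂ F) ⟩
    - (if isF₂ F then w F * (κ F * κ F) else 0#) ∎
    where
    open CommutativeSemigroupProperties *-commutativeSemigroup using (x∙yz≈y∙xz)
    negate : ∀ b → w F * (if b then - (κ F * κ F) else 0#) ≈ - (if b then w F * (κ F * κ F) else 0#)
    negate true  = ≈-sym (-‿distribʳ-* (w F) (κ F * κ F))
    negate false = ≈-trans (zeroʳ _) (≈-sym ε⁻¹≈ε)

  α-sum-F₁ : sumFin m α * Forests.sumF₁ G α S conn? acyc? w ≈ sumList subsets (λ T → sumFin m α * ([ isF₁ T ] * w T))
  α-sum-F₁ = ≈-trans (*-distribˡ-sumList subsets _ _) (sumList-cong subsets (λ T → *-congˡ (if-then-0≈[]* (isF₁ T) (w T))))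

theorem5p3 : ∀ {c ℓ} (R : CommutativeRing c ℓ) {n m : ℕ} (G : Graph n m) →
    IsTree G →
    (α : Fin m → CommutativeRing.Carrier R) →
    (D : Fin n → Fin n → CommutativeRing.Carrier R) →
    (∀ u v (p : Walk G (fullSet G) u v) → IsPath G p →
      CommutativeRing._≈_ R (D u v)
        (RingSums.sumList R (walkEdges G p) α)) →
    (S : Subset n) → Σ (Fin n) (λ s → s ∈ S) →
    (conn? : ∀ A u v → Dec (Walk G A u v)) →
    (acyc? : ∀ A → Dec (Acyclic G A)) →
    ∀ u → u ∈ S →
      CommutativeRing._≈_ R
        (RingSums.sumFin R n (λ v →
          if v ∈ᵇ S
          then CommutativeRing._*_ R (D u v)
                 (RingSums.Forests.mvec R G α S conn? acyc? v)
          else CommutativeRing.0# R))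
        (RingSums.Forests.lam R G α S conn? acyc?)
theorem5p3 R {n} {m} G tree α D D-paths S _ conn? acyc? u u∈S = begin
  sumFin n (λ v → if v ∈ᵇ S then D u v * mvec v else 0#)
    ≈⟨ distance-weighted-sum ⟩
  sumList subsets treeTerm
    ≈⟨ ≈-trans (sumList-cong subsets treeTerm-split) (sumList-+ subsets _ _) ⟩
  sumList subsets (λ T → sumFin m α * ([ isF₁ T ] * w T))
    + sumList subsets (λ T → sumFin m (λ e → [ lookup T e ] * insertionTerm e T))
    ≈⟨ +-cong (≈-sym α-sum-F₁) (sumList-sumFin-swap subsets m _) ⟩
  sumFin m α * sumF₁ w + sumFin m (λ e → sumList subsets (λ T → [ lookup T e ] * insertionTerm e T))
    ≈⟨ +-congˡ (sumFin-cong m (λ e → sumList-allSubsets-insert m e (insertionTerm e))) ⟩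
  sumFin m α * sumF₁ w + sumFin m (λ e → sumList subsets (λ F → [ not (lookup F e) ] * insertionTerm e (F [ e ]≔ true)))
    ≈⟨ +-congˡ (≈-trans (≈-sym (sumList-sumFin-swap subsets m _)) (sumList-cong subsets (λ F → sum-insertionTerms F u∈Sᵇ))) ⟩
  sumFin m α * sumF₁ w + sumList subsets (λ F → - (if isF₂ F then w F * (κ F * κ F) else 0#))
    ≈⟨ +-congˡ (sumList-neg subsets _) ⟩
  lam ∎
  where
  open CommutativeRing R renaming (refl to ≈-refl; sym to ≈-sym; trans to ≈-trans)
  open RingSums R
  open RingSumProperties R
  open Forests G α S conn? acyc? using (w; mvec; lam; sumF₁)
  open Assembly R tree α D D-paths S conn? acyc? u
  open import Relation.Binary.Reasoning.Setoid setoid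
  u∈Sᵇ : inS u ≡ true
  u∈Sᵇ = trans (∈ᵇ≡lookup u S) (∈⇒lookup u∈S)
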